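{- Let $X,Y$ be lower Eulerian posets with rank functions $\rho_X,\rho_Y$, $\sigma:X\to Y$ a strong formal subdivision with associated poset $\Gamma$, $r_\Gamma\in I(\Gamma)$ a weak rank function and $\kappa_\Gamma\in\mathcal{I}(\Gamma)\cap U(\Gamma)$ multiplicative and rank alternating (as in the context). Then \[ Z_\Gamma|_{X/Y}=-Z_\Gamma|_X\cdot\Delta\widehat{\ell_\sigma}+(\Delta\ell_\sigma)^{\mathrm{rev}}\cdot Z_\Gamma|_Y.\] That is, for all $x\in X$, $y\in Y$ with $\sigma(x)\le y$, \[Z_\Gamma(x,y)=\sum_{x\le x'\in X,\ \sigma(x')\le y}(-1)^{\rho_Y(y)-\rho_X(x')}Z_X(x,x')\Delta\ell_\sigma(x',y)+\sum_{\sigma(x)\le y'\le y}(\Delta\ell_\sigma)^{\mathrm{rev}}(x,y')Z_Y(y',y).\]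
   Context: All posets are finite. For a poset $B$, $I(B)$ is the set of functions $p$ from closed intervals $[z,z']$ of $B$ to $\mathbb{Z}[t]$, a $\mathbb{Z}[t]$-algebra with pointwise sum and scalars and product $(p\cdot p')(z,z')=\sum_{z\le z''\le z'}p(z,z'')p'(z'',z')$. A weak rank function is $r_B\in I(B)$ with nonnegative integer values, positive for $z<z'$, additive along chains. $\mathcal{I}(B)=\{p:\deg p(z,z')\le r_B(z,z')\}$ with involution $p^{\mathrm{rev}}(z,z';t)=t^{r_B(z,z')}p(z,z';t^{ -1})$; $\mathcal{I}_{1/2}(B)=\{p\in\mathcal{I}(B):\deg p(z,z')<r_B(z,z')/2$ for $z<z'\}$; $U(B)=\{p:p(z,z)=1\}$. A $B$-kernel is $\kappa\in\mathcal{I}(B)\cap U(B)$ with $\kappa^{ -1}=\kappa^{\mathrm{rev}}$; its right and left KLS functions are the unique $f_B,g_B\in\mathcal{I}_{1/2}(B)\cap U(B)$ with $f_B^{\mathrm{rev}}=\kappa\cdot f_B$, $g_B^{\mathrm{rev}}=g_B\cdot\kappa$, and its $Z$-function is $Z_B=g_B\cdot\kappa\cdot f_B$. For $p\in\mathcal{I}(B)$, $(\Delta p)(z,z)=0$ and, for $z<z'$ with $p(z,z')=\sum_ia_it^i$, $(\Delta p)(z,z')=a_0+\sum_{i=1}^{\lfloor(r_B(z,z')-1)/2\rfloor}(a_i-a_{i-1})t^i$. A poset is lower Eulerian if it has a unique minimal element, a rank function $\rho_B$ ($\rho_B(z')=\rho_B(z)+1$ when $z'$ covers $z$), and $\sum_{z\le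 z''\le z'}(-1)^{\rho_B(z'')}=0$ for $z<z'$; $\rho_B(z,z')=\rho_B(z')-\rho_B(z)$. For lower Eulerian $B$, $\widehat p(z,z')=(-1)^{\rho_B(z,z')}p(z,z')$; $p$ is rank alternating if $p^{\mathrm{rev}}=\widehat p$, multiplicative if $p(z,z')=p(z,z'')p(z'',z')$ for $z\le z''\le z'$; such elements of $\mathcal{I}(B)\cap U(B)$ are $B$-kernels. Setting: $X,Y$ lower Eulerian; $\sigma:X\to Y$ a strong formal subdivision: order-preserving; $\rho_X(x)\le\rho_Y(\sigma(x))$; surjective, and for $x\in X,y\in Y$ with $\sigma(x)\le y$ there is $x'\ge x$ with $\rho_X(x')=\rho_Y(y)$, $\sigma(x')=y$; and $\sum_{x\le x'\in X,\sigma(x')=y}(-1)^{\rho_Y(y)-\rho_X(x')}=1$ for all such $x,y$. $\Gamma$ is the poset on $X\sqcup Y$ with the orders of $X,Y$ and $x\le y$ ($x\in X,y\in Y$) iff $\sigma(x)\le y$; it is lower Eulerian with rank function $\rho_X$ on $X$ and $\rho_Y+1$ on $Y$. $g_\Gamma,Z_\Gamma$ are the left KLS function and $Z$-function of $\kappa_\Gamma$; $Z_X$, $Z_Y$ are the restrictions of $Z_\Gamma$ to intervals in $X$, resp. $Y$. For $p\in\mathcal{I}(\Gamma)$, $p|_X,p|_Y,p|_{X/Y},p|_{(X/Y)^\circ}$ agree with $p$ on intervals $[z,z']$ with $z,z'\in X$; $z,z'\in Y$; $z\in X,z'\in Y$; $z\in X,z'=\sigma(z)$ respectively, and are $0$ elsewhere.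 $h_\sigma,\ell_\sigma\in\mathcal{I}(\Gamma)$: $(t-1)\cdot h_\sigma=g_\Gamma\cdot\kappa_\Gamma|_{(X/Y)^\circ}$ (right side divisible by $t-1$), $\ell_\sigma=h_\sigma\cdot g_\Gamma^{ -1}$. -}

module Defs where

open import Data.Nat as ℕ using (ℕ; zero; suc; ⌊_/2⌋; _∸_)
open import Data.Integer as ℤ using (ℤ; 0ℤ; 1ℤ; -_)
open import Data.Bool using (Bool; true; false; if_then_else_; _∧_)
open import Data.List using (List; []; _∷_; _++_; map; upTo)
open import Data.List.Membership.Propositional using (_∈_)
open import Data.List.Relation.Unary.Unique.Propositional using (Unique)
open import Data.Sum using (_⊎_; inj₁; inj₂)
open import Data.Sum.Properties using (≡-dec)
open import Data.Product using (Σ; ∃; _×_; _,_)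
open import Data.Empty using (⊥)
open import Relation.Nullary using (¬_; Dec; yes; no; does)
open import Relation.Binary using (Decidable; DecidableEquality)
open import Relation.Binary.PropositionalEquality using (_≡_)

-- Polynomials in ℤ[t], represented by their coefficient sequences
-- (p k = coefficient of t^k).  Equality is coefficientwise.

Poly : Set
Poly = ℕ → ℤ

infix 4 _≈ₚ_
_≈ₚ_ : Poly → Poly → Set
p ≈ₚ q = ∀ k → p k ≡ q k

0ₚ : Poly
0ₚ _ = 0ℤ

1ₚ : Poly
1ₚ zero    = 1ℤ
1ₚ (suc _) = 0ℤ

t-1ₚ : Poly
t-1ₚ zero          = - 1ℤ
t-1ₚ (suc zero)    = 1ℤ
t-1ₚ (suc (suc _)) = 0ℤ

infixl 6 _+ₚ_
_+ₚ_ : Poly → Poly → Poly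
(p +ₚ q) k = p k ℤ.+ q k

-ₚ_ : Poly → Poly
(-ₚ p) k = - p k

infixl 7 _·ₚ_
_·ₚ_ : ℤ → Poly → Poly
(c ·ₚ p) k = c ℤ.* p k

Σℤ : {A : Set} → List A → (A → Bool) → (A → ℤ) → ℤ
Σℤ []       b F = 0ℤ
Σℤ (a ∷ as) b F = if b a then F a ℤ.+ Σℤ as b F else Σℤ as b F

Σₚ : {A : Set} → List A → (A → Bool) → (A → Poly) → Poly
Σₚ as b F k = Σℤ as b (λ a → F a k)

infixl 7 _*ₚ_
_*ₚ_ : Poly → Poly → Poly
(p *ₚ q) k = Σℤ (upTo (suc k)) (λ _ → true) (λ i → p i ℤ.* q (k ∸ i))

DegLe : ℕ → Poly → Set
DegLe r p = ∀ k → r ℕ.< k → p k ≡ 0ℤ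

DegLtHalf : ℕ → Poly → Set
DegLtHalf r p = ∀ k → r ℕ.≤ k ℕ.+ k → p k ≡ 0ℤ

-- t^r p(t^{-1})
rev : ℕ → Poly → Poly
rev r p k = if does (k ℕ.≤? r) then p (r ∸ k) else 0ℤ

sign : ℕ → ℤ
sign zero    = 1ℤ
sign (suc n) = - sign n

record FinOrd : Set₁ where
  field
    Carrier : Set
    _≤_     : Carrier → Carrier → Set
    _≤?_    : Decidable _≤_
    _≟_     : DecidableEquality Carrier
    elems   : List Carrier

record IsFinPoset (P : FinOrd) : Set where
  open FinOrd P
  field
    elems-complete : ∀ z → z ∈ elems
    elems-unique   : Unique elems
    ≤-refl         : ∀ z → z ≤ z
    ≤-antisym      : ∀ {z z'} → z ≤ z' → z' ≤ z → z ≡ z'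
    ≤-trans        : ∀ {z z' z''} → z ≤ z' → z' ≤ z'' → z ≤ z''

module _ (P : FinOrd) where
  open FinOrd P

  _<ₒ_ : Carrier → Carrier → Set
  z <ₒ z' = z ≤ z' × ¬ (z ≡ z')

  Covers : Carrier → Carrier → Set
  Covers z z' = z <ₒ z' × (∀ w → z <ₒ w → w <ₒ z' → ⊥)

  inInterval : Carrier → Carrier → Carrier → Bool
  inInterval z z' w = does (z ≤? w) ∧ does (w ≤? z')

  record IsLowerEulerian (ρ : Carrier → ℕ) : Set where
    field
      bottom     : Carrier
      bottom-min : ∀ z → bottom ≤ z
      rank-cover : ∀ z z' → Covers z z' → ρ z' ≡ suc (ρ z)
      eulerian   : ∀ z z' → z <ₒ z' →
                   Σℤ elems (inInterval z z') (λ w → sign (ρ w)) ≡ 0ℤ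

  -- Incidence algebra I(P): functions on pairs (only values on
  -- intervals z ≤ z' are ever used).

  Inc : Set
  Inc = Carrier → Carrier → Poly

  infixl 7 _⊛_
  _⊛_ : Inc → Inc → Inc
  (p ⊛ q) z z' = Σₚ elems (inInterval z z') (λ w → p z w *ₚ q w z')

  δ : Inc
  δ z z' = if does (z ≟ z') then 1ₚ else 0ₚ

  record IsWeakRank (r : Carrier → Carrier → ℕ) : Set where
    field
      positive : ∀ z z' → z <ₒ z' → 0 ℕ.< r z z'
      additive : ∀ z w z' → z ≤ w → w ≤ z' → r z z' ≡ r z w ℕ.+ r w z'

  module _ (r : Carrier → Carrier → ℕ) where

    InCalI : Inc → Set
    InCalI p = ∀ z z' → z ≤ z' → DegLe (r z z') (p z z')

    InCalIHalf : Inc → Set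
    InCalIHalf p = InCalI p × (∀ z z' → z <ₒ z' → DegLtHalf (r z z') (p z z'))

    InU : Inc → Set
    InU p = ∀ z → p z z ≈ₚ 1ₚ

    revI : Inc → Inc
    revI p z z' = rev (r z z') (p z z')

    IsRightKLS : Inc → Inc → Set
    IsRightKLS κ f = InCalIHalf f × InU f ×
      (∀ z z' → z ≤ z' → revI f z z' ≈ₚ (κ ⊛ f) z z')

    IsLeftKLS : Inc → Inc → Set
    IsLeftKLS κ g = InCalIHalf g × InU g ×
      (∀ z z' → z ≤ z' → revI g z z' ≈ₚ (g ⊛ κ) z z')

    Δ : Inc → Inc
    Δ p z z' k with does (z ≟ z')
    ... | true  = 0ℤ
    ... | false = Δcoef k
      where
        Δcoef : ℕ → ℤ
        Δcoef zero    = p z z' zero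
        Δcoef (suc j) = if does (suc j ℕ.≤? ⌊ r z z' ∸ 1 /2⌋)
                        then p z z' (suc j) ℤ.- p z z' j else 0ℤ

  IsInverse : Inc → Inc → Set
  IsInverse g ginv = ∀ z z' → z ≤ z' →
    ((g ⊛ ginv) z z' ≈ₚ δ z z') × ((ginv ⊛ g) z z' ≈ₚ δ z z')

  module _ (ρ : Carrier → ℕ) where
    hatI : Inc → Inc
    hatI p z z' = sign (ρ z' ∸ ρ z) ·ₚ p z z'

  Multiplicative : Inc → Set
  Multiplicative p = ∀ z w z' → z ≤ w → w ≤ z' → p z z' ≈ₚ p z w *ₚ p w z'

  RankAlternating : (Carrier → Carrier → ℕ) → (Carrier → ℕ) → Inc → Set
  RankAlternating r ρ p = ∀ z z' → z ≤ z' → revI r p z z' ≈ₚ hatI ρ p z z'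

module _ (X Y : FinOrd) where
  private
    module X = FinOrd X
    module Y = FinOrd Y

  record IsStrongFormalSubdivision (ρX : X.Carrier → ℕ) (ρY : Y.Carrier → ℕ)
                                   (σ : X.Carrier → Y.Carrier) : Set where
    field
      order-preserving : ∀ {x x'} → x X.≤ x' → σ x Y.≤ σ x'
      rank-le          : ∀ x → ρX x ℕ.≤ ρY (σ x)
      surjective       : ∀ y → ∃ λ x → σ x ≡ y
      lift             : ∀ x y → σ x Y.≤ y →
                         ∃ λ x' → x X.≤ x' × ρX x' ≡ ρY y × σ x' ≡ y
      alternating-sum  : ∀ x y → σ x Y.≤ y →
                         Σℤ X.elems (λ x' → does (x X.≤? x') ∧ does (σ x' Y.≟ y))
                            (λ x' → sign (ρY y ∸ ρX x')) ≡ 1ℤ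

  module _ (σ : X.Carrier → Y.Carrier) where

    _≤Γ_ : X.Carrier ⊎ Y.Carrier → X.Carrier ⊎ Y.Carrier → Set
    inj₁ x ≤Γ inj₁ x' = x X.≤ x'
    inj₁ x ≤Γ inj₂ y  = σ x Y.≤ y
    inj₂ y ≤Γ inj₁ x  = ⊥
    inj₂ y ≤Γ inj₂ y' = y Y.≤ y'

    _≤Γ?_ : Decidable _≤Γ_
    inj₁ x ≤Γ? inj₁ x' = x X.≤? x'
    inj₁ x ≤Γ? inj₂ y  = σ x Y.≤? y
    inj₂ y ≤Γ? inj₁ x  = no (λ ())
    inj₂ y ≤Γ? inj₂ y' = y Y.≤? y'

    ΓOrd : FinOrd
    ΓOrd = record
      { Carrier = X.Carrier ⊎ Y.Carrier
      ; _≤_     = _≤Γ_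
      ; _≤?_    = _≤Γ?_
      ; _≟_     = ≡-dec X._≟_ Y._≟_
      ; elems   = map inj₁ X.elems ++ map inj₂ Y.elems
      }

    restrict° : Inc ΓOrd → Inc ΓOrd
    restrict° p (inj₁ x) (inj₂ y) = if does (σ x Y.≟ y) then p (inj₁ x) (inj₂ y) else 0ₚ
    restrict° p _        _        = 0ₚ

  ρΓ : (X.Carrier → ℕ) → (Y.Carrier → ℕ) → X.Carrier ⊎ Y.Carrier → ℕ
  ρΓ ρX ρY (inj₁ x) = ρX x
  ρΓ ρX ρY (inj₂ y) = suc (ρY y)

-- Everything happens in the incidence algebra of Γ.  As κ is multiplicative and Γ is Eulerian,
-- hat κ is the inverse of κ, and a symmetry argument on degrees shows that hat f is the inverse
-- of g.  With κ° the restriction of κ to the pairs (x , σ x), the definition of h gives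
-- L = (t - 1) ℓ = g κ° (hat f); as κ is rank alternating, rev L = -L, hence D = Δ ℓ, the part
-- of -L below half the rank, satisfies rev D = D + L.  On X/Y this forces g = D g and
-- f = -(f hat D): each difference solves a KLS-type equation while having degree below half
-- the rank, and such a solution vanishes by induction on the rank of the interval.  Splitting
-- Z = (g κ) f over the X/Y-parts of its two factors gives Z = -(Z hat D) + (rev D) Z on X/Y,
-- which is the stated formula written out.

module Submission where

open import Defs
open import Data.Nat using (ℕ; _∸_)
open import Data.Bool using (_∧_)
open import Data.Sum using (inj₁; inj₂)
open import Relation.Nullary using (does)

open import Data.Bool.Base using (Bool; true; false; if_then_else_; T)
open import Data.Bool.Properties using (T-∧; ∧-identityʳ)
open import Data.Empty using (⊥-elim)
open import Data.Integer.Base as ℤ using (ℤ; 0ℤ; 1ℤ; -_; _+_; _*_)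
import Data.Integer.Properties as ℤ
open import Data.Integer.Tactic.RingSolver using (solve-∀)
open import Data.List.Base using (List; []; _∷_; _++_; map; upTo; applyUpTo)
import Data.List.Properties as List
open import Data.List.Membership.Propositional using (_∈_; lose)
open import Data.List.Membership.Propositional.Properties using (∈-upTo⁻; ∈-++⁺ˡ; ∈-++⁺ʳ; ∈-map⁺; ∈-map⁻)
import Data.List.Relation.Unary.All as All
open import Data.List.Relation.Unary.AllPairs using (_∷_)
open import Data.List.Relation.Unary.Any using (here; there; any?; satisfied)
open import Data.List.Relation.Unary.Unique.Propositional using (Unique)
import Data.List.Relation.Unary.Unique.Propositional.Properties as Unique
open import Data.Nat.Base as ℕ using (zero; suc; _<_; s≤s; ⌊_/2⌋)
import Data.Nat.Properties as ℕ
import Data.Nat.Tactic.RingSolver as ℕ-Solver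
open import Data.Product.Base using (_×_; _,_; proj₁; proj₂; ∃-syntax)
open import Data.Product.Function.NonDependent.Propositional using (_×-⇔_)
open import Data.Sum.Base using (_⊎_; [_,_]′)
open import Data.Sum.Properties using (inj₁-injective; inj₂-injective)
open import Data.Unit.Base using (tt)
open import Function.Base using (_∘_; const)
open import Function.Bundles using (_⇔_; mk⇔; Equivalence)
open import Function.Construct.Composition using (_⇔-∘_)
open import Relation.Binary.Bundles using (Setoid)
open import Relation.Binary.Definitions using (tri<; tri≈; tri>)
open import Relation.Binary.PropositionalEquality
import Relation.Binary.Reasoning.Setoid as SetoidReasoning
open import Relation.Nullary using (¬_; Dec; yes; no)
open import Relation.Nullary.Decidable using (dec-true; dec-false; _×-dec_; ¬?)
open import Algebra.Properties.AbelianGroup ℤ.+-0-abelianGroup using (inverseˡ-unique)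

open Equivalence using (to; from)

-- Filtered sums

private
  variable
    A B : Set

T-does : ∀ {P : Set} (P? : Dec P) → T (does P?) ⇔ P
T-does (yes p) = mk⇔ (const p) (const tt)
T-does (no ¬p) = mk⇔ (λ ()) ¬p

T-∧⇔ : ∀ {x y} {P Q : Set} → T x ⇔ P → T y ⇔ Q → T (x ∧ y) ⇔ (P × Q)
T-∧⇔ x⇔P y⇔Q = (x⇔P ×-⇔ y⇔Q) ⇔-∘ T-∧

T-does-∧ : ∀ {P Q : Set} (P? : Dec P) (Q? : Dec Q) → T (does P? ∧ does Q?) ⇔ (P × Q)
T-does-∧ P? Q? = T-∧⇔ (T-does P?) (T-does Q?)

T-injective : ∀ {x y} → T x ⇔ T y → x ≡ y
T-injective {false} {false} _ = refl
T-injective {false} {true}  x⇔y = ⊥-elim (from x⇔y tt)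
T-injective {true}  {false} x⇔y = ⊥-elim (to x⇔y tt)
T-injective {true}  {true}  _ = refl

Σℤ-cong : ∀ (l : List A) b {F G : A → ℤ} →
          (∀ a → a ∈ l → T (b a) → F a ≡ G a) → Σℤ l b F ≡ Σℤ l b G
Σℤ-cong []      b F≡G = refl
Σℤ-cong (a ∷ l) b F≡G with b a in ba
... | true  = cong₂ _+_ (F≡G a (here refl) (subst T (sym ba) tt)) (Σℤ-cong l b (λ a′ → F≡G a′ ∘ there))
... | false = Σℤ-cong l b (λ a′ → F≡G a′ ∘ there)

Σℤ-filter-cong : ∀ (l : List A) {b c} (F : A → ℤ) → (∀ a → b a ≡ c a) → Σℤ l b F ≡ Σℤ l c F
Σℤ-filter-cong []      F b≡c = refl
Σℤ-filter-cong (a ∷ l) F b≡c rewrite b≡c a = cong (λ s → if _ then F a + s else s) (Σℤ-filter-cong l F b≡c)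

Σℤ-zero : ∀ (l : List A) b (F : A → ℤ) → (∀ a → a ∈ l → T (b a) → F a ≡ 0ℤ) → Σℤ l b F ≡ 0ℤ
Σℤ-zero []      b F F≡0 = refl
Σℤ-zero (a ∷ l) b F F≡0 with b a in ba
... | true  = trans (cong₂ _+_ (F≡0 a (here refl) (subst T (sym ba) tt)) (Σℤ-zero l b F (λ a′ → F≡0 a′ ∘ there)))
                    (ℤ.+-identityˡ 0ℤ)
... | false = Σℤ-zero l b F (λ a′ → F≡0 a′ ∘ there)

Σℤ-+ : ∀ (l : List A) b (F G : A → ℤ) → Σℤ l b (λ a → F a + G a) ≡ Σℤ l b F + Σℤ l b G
Σℤ-+ []      b F G = refl
Σℤ-+ (a ∷ l) b F G with b a
... | true  = trans (cong (F a + G a +_) (Σℤ-+ l b F G)) (swap-middle (F a) (G a) _ _)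
  where
    swap-middle : ∀ w x y z → (w + x) + (y + z) ≡ (w + y) + (x + z)
    swap-middle = solve-∀
... | false = Σℤ-+ l b F G

Σℤ-neg : ∀ (l : List A) b (F : A → ℤ) → Σℤ l b (λ a → - F a) ≡ - Σℤ l b F
Σℤ-neg []      b F = refl
Σℤ-neg (a ∷ l) b F with b a
... | true  = trans (cong (- F a +_) (Σℤ-neg l b F)) (sym (ℤ.neg-distrib-+ (F a) _))
... | false = Σℤ-neg l b F

Σℤ-*ˡ : ∀ (l : List A) b c (F : A → ℤ) → c * Σℤ l b F ≡ Σℤ l b (λ a → c * F a)
Σℤ-*ˡ []      b c F = ℤ.*-zeroʳ c
Σℤ-*ˡ (a ∷ l) b c F with b a
... | true  = trans (ℤ.*-distribˡ-+ c (F a) _) (cong (c * F a +_) (Σℤ-*ˡ l b c F))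
... | false = Σℤ-*ˡ l b c F

Σℤ-*ʳ : ∀ (l : List A) b c (F : A → ℤ) → Σℤ l b F * c ≡ Σℤ l b (λ a → F a * c)
Σℤ-*ʳ l b c F = trans (ℤ.*-comm _ c) (trans (Σℤ-*ˡ l b c F) (Σℤ-cong l b (λ a _ _ → ℤ.*-comm c (F a))))

Σℤ-++ : ∀ (l l′ : List A) b (F : A → ℤ) → Σℤ (l ++ l′) b F ≡ Σℤ l b F + Σℤ l′ b F
Σℤ-++ []      l′ b F = sym (ℤ.+-identityˡ _)
Σℤ-++ (a ∷ l) l′ b F with b a
... | true  = trans (cong (F a +_) (Σℤ-++ l l′ b F)) (sym (ℤ.+-assoc (F a) _ _))
... | false = Σℤ-++ l l′ b F

Σℤ-map : ∀ (f : A → B) (l : List A) b (F : B → ℤ) → Σℤ (map f l) b F ≡ Σℤ l (b ∘ f) (F ∘ f)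
Σℤ-map f []      b F = refl
Σℤ-map f (a ∷ l) b F with b (f a)
... | true  = cong (F (f a) +_) (Σℤ-map f l b F)
... | false = Σℤ-map f l b F

Σℤ-single : ∀ {l : List A} b (F : A → ℤ) {a} → Unique l → a ∈ l → T (b a) →
            (∀ a′ → T (b a′) → a′ ≢ a → F a′ ≡ 0ℤ) → Σℤ l b F ≡ F a
Σℤ-single {l = a ∷ l} b F (a∉l ∷ _) (here refl) ba others with b a
... | true  = trans (cong (F a +_) (Σℤ-zero l b F λ a′ a′∈l ba′ → others a′ ba′ λ { refl → All.lookup a∉l a′∈l refl }))
                    (ℤ.+-identityʳ (F a))
... | false = ⊥-elim ba
Σℤ-single {l = a′ ∷ l} b F (a′∉l ∷ l-unique) (there a∈l) ba others with b a′ in ba′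
... | true  = trans (cong₂ _+_ (others a′ (subst T (sym ba′) tt) (λ { refl → All.lookup a′∉l a∈l refl }))
                               (Σℤ-single b F l-unique a∈l ba others))
                    (ℤ.+-identityˡ _)
... | false = Σℤ-single b F l-unique a∈l ba others

private
  Σℤ-nest : ∀ (l : List A) (l′ : List B) (b : A → Bool) (c : A → B → Bool) (F : A → B → ℤ) →
            Σℤ l b (λ a → Σℤ l′ (c a) (F a)) ≡ Σℤ l (const true) (λ a → Σℤ l′ (λ a′ → b a ∧ c a a′) (F a))
  Σℤ-nest []      l′ b c F = refl
  Σℤ-nest (a ∷ l) l′ b c F with b a
  ... | true  = cong (Σℤ l′ (c a) (F a) +_) (Σℤ-nest l l′ b c F)
  ... | false = trans (Σℤ-nest l l′ b c F)
                      (sym (trans (cong (_+ _) (Σℤ-zero l′ (const false) (F a) (λ _ _ ()))) (ℤ.+-identityˡ _)))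

  Σℤ-if-+ : ∀ (l : List A) (d : A → Bool) (G S : A → ℤ) →
            Σℤ l (const true) (λ a → if d a then G a + S a else S a) ≡ Σℤ l d G + Σℤ l (const true) S
  Σℤ-if-+ []      d G S = refl
  Σℤ-if-+ (a ∷ l) d G S with d a
  ... | true  = trans (cong (G a + S a +_) (Σℤ-if-+ l d G S)) (regroup (G a) (S a) _ _)
    where
      regroup : ∀ w x y z → (w + x) + (y + z) ≡ (w + y) + (x + z)
      regroup = solve-∀
  ... | false = trans (cong (S a +_) (Σℤ-if-+ l d G S)) (regroup (S a) (Σℤ l d G) _)
    where
      regroup : ∀ x y z → x + (y + z) ≡ y + (x + z)
      regroup = solve-∀

  Σℤ-swap-outer : ∀ (l : List A) (l′ : List B) (d : A → B → Bool) (F : A → B → ℤ) →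
                  Σℤ l (const true) (λ a → Σℤ l′ (d a) (F a)) ≡
                  Σℤ l′ (const true) (λ a′ → Σℤ l (λ a → d a a′) (λ a → F a a′))
  Σℤ-swap-outer []      l′ d F = sym (Σℤ-zero l′ (const true) _ (λ _ _ _ → refl))
  Σℤ-swap-outer (a ∷ l) l′ d F =
    trans (cong (Σℤ l′ (d a) (F a) +_) (Σℤ-swap-outer l l′ d F))
          (sym (Σℤ-if-+ l′ (d a) (F a) (λ a′ → Σℤ l (λ a → d a a′) (λ a → F a a′))))

Σℤ-swap : ∀ (l : List A) (l′ : List B) {b : A → Bool} {c : A → B → Bool} {b′ : B → Bool} {c′ : B → A → Bool}
          (F : A → B → ℤ) →
          (∀ a a′ → T (b a ∧ c a a′) ⇔ T (b′ a′ ∧ c′ a′ a)) →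
          Σℤ l b (λ a → Σℤ l′ (c a) (F a)) ≡ Σℤ l′ b′ (λ a′ → Σℤ l (c′ a′) (λ a → F a a′))
Σℤ-swap l l′ {b} {c} {b′} {c′} F same-pairs = begin
  Σℤ l b (λ a → Σℤ l′ (c a) (F a))
    ≡⟨ Σℤ-nest l l′ b c F ⟩
  Σℤ l (const true) (λ a → Σℤ l′ (λ a′ → b a ∧ c a a′) (F a))
    ≡⟨ Σℤ-swap-outer l l′ (λ a a′ → b a ∧ c a a′) F ⟩
  Σℤ l′ (const true) (λ a′ → Σℤ l (λ a → b a ∧ c a a′) (λ a → F a a′))
    ≡⟨ Σℤ-cong l′ (const true) (λ a′ _ _ → Σℤ-filter-cong l {λ a → b a ∧ c a a′} {λ a → b′ a′ ∧ c′ a′ a}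
                                                          (λ a → F a a′) (λ a → T-injective (same-pairs a a′))) ⟩
  Σℤ l′ (const true) (λ a′ → Σℤ l (λ a → b′ a′ ∧ c′ a′ a) (λ a → F a a′))
    ≡⟨ Σℤ-nest l′ l b′ c′ (λ a′ a → F a a′) ⟨
  Σℤ l′ b′ (λ a′ → Σℤ l (c′ a′) (λ a → F a a′)) ∎
  where open ≡-Reasoning

Σℤ-if : ∀ (l : List A) (b c : A → Bool) (F : A → ℤ) →
        Σℤ l b (λ a → if c a then F a else 0ℤ) ≡ Σℤ l (λ a → b a ∧ c a) F
Σℤ-if []      b c F = refl
Σℤ-if (a ∷ l) b c F with b a | c a
... | true  | true  = cong (F a +_) (Σℤ-if l b c F)
... | true  | false = trans (ℤ.+-identityˡ _) (Σℤ-if l b c F)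
... | false | _     = Σℤ-if l b c F

-- Polynomials

-- A module only to keep the order of ℕ out of the scope of the poset orders below.
module Polynomials where

  open import Data.Nat using (_≤_; _≤?_)

  module ≈ₚ-Reasoning = SetoidReasoning (ℕ →-setoid ℤ)
  open Setoid (ℕ →-setoid ℤ) public
    using () renaming (refl to ≈ₚ-refl; sym to ≈ₚ-sym; trans to ≈ₚ-trans)

  shift : Poly → Poly
  shift p k = p (suc k)

  +ₚ-cong : ∀ {p p′ q q′} → p ≈ₚ p′ → q ≈ₚ q′ → p +ₚ q ≈ₚ p′ +ₚ q′
  +ₚ-cong p≈p′ q≈q′ k = cong₂ _+_ (p≈p′ k) (q≈q′ k)

  *ₚ-cong : ∀ {p p′ q q′} → p ≈ₚ p′ → q ≈ₚ q′ → p *ₚ q ≈ₚ p′ *ₚ q′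
  *ₚ-cong p≈p′ q≈q′ k = Σℤ-cong (upTo (suc k)) (const true) (λ i _ _ → cong₂ _*_ (p≈p′ i) (q≈q′ (k ∸ i)))

  *ₚ-coeff₀ : ∀ p q → (p *ₚ q) 0 ≡ p 0 * q 0
  *ₚ-coeff₀ p q = ℤ.+-identityʳ (p 0 * q 0)

  -- The ring laws below follow from these two recursions by induction on the coefficient index.
  *ₚ-shiftˡ : ∀ p q → shift (p *ₚ q) ≈ₚ p 0 ·ₚ shift q +ₚ shift p *ₚ q
  *ₚ-shiftˡ p q k = cong (p 0 * q (suc k) +_) (begin
    Σℤ (applyUpTo suc (suc k)) (const true) F    ≡⟨ cong (λ l → Σℤ l (const true) F) (List.map-upTo suc (suc k)) ⟨
    Σℤ (map suc (upTo (suc k))) (const true) F   ≡⟨ Σℤ-map suc (upTo (suc k)) (const true) F ⟩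
    (shift p *ₚ q) k                             ∎)
    where
      open ≡-Reasoning
      F = λ i → p i * q (suc k ∸ i)

  *ₚ-shiftʳ : ∀ p q k → (p *ₚ q) (suc k) ≡ (p *ₚ shift q) k + p (suc k) * q 0
  *ₚ-shiftʳ p q k = begin
    Σℤ (upTo (suc (suc k))) (const true) F                ≡⟨ cong (λ l → Σℤ l (const true) F) (List.upTo-∷ʳ (suc k)) ⟨
    Σℤ (upTo (suc k) ++ suc k ∷ []) (const true) F        ≡⟨ Σℤ-++ (upTo (suc k)) _ (const true) F ⟩
    Σℤ (upTo (suc k)) (const true) F + (F (suc k) + 0ℤ)   ≡⟨ cong₂ _+_ inner last ⟩
    (p *ₚ shift q) k + p (suc k) * q 0                    ∎
    where
      open ≡-Reasoning
      F = λ i → p i * q (suc k ∸ i)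
      inner : Σℤ (upTo (suc k)) (const true) F ≡ (p *ₚ shift q) k
      inner = Σℤ-cong (upTo (suc k)) (const true) λ i i∈ _ →
        cong (λ j → p i * q j) (ℕ.+-∸-assoc 1 (ℕ.≤-pred (∈-upTo⁻ i∈)))
      last : F (suc k) + 0ℤ ≡ p (suc k) * q 0
      last = trans (ℤ.+-identityʳ _) (cong (λ j → p (suc k) * q j) (ℕ.n∸n≡0 k))

  *ₚ-comm : ∀ p q → p *ₚ q ≈ₚ q *ₚ p
  *ₚ-comm p q zero    = cong (_+ 0ℤ) (ℤ.*-comm (p 0) (q 0))
  *ₚ-comm p q (suc k) = begin
    (p *ₚ q) (suc k)                     ≡⟨ *ₚ-shiftˡ p q k ⟩
    p 0 * q (suc k) + (shift p *ₚ q) k   ≡⟨ cong₂ _+_ (ℤ.*-comm (p 0) (q (suc k))) (*ₚ-comm (shift p) q k) ⟩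
    q (suc k) * p 0 + (q *ₚ shift p) k   ≡⟨ ℤ.+-comm (q (suc k) * p 0) ((q *ₚ shift p) k) ⟩
    (q *ₚ shift p) k + q (suc k) * p 0   ≡⟨ *ₚ-shiftʳ q p k ⟨
    (q *ₚ p) (suc k)                     ∎
    where open ≡-Reasoning

  *ₚ-distribˡ : ∀ p q s → p *ₚ (q +ₚ s) ≈ₚ p *ₚ q +ₚ p *ₚ s
  *ₚ-distribˡ p q s k = trans (Σℤ-cong (upTo (suc k)) (const true) (λ i _ _ → ℤ.*-distribˡ-+ (p i) (q (k ∸ i)) (s (k ∸ i))))
                              (Σℤ-+ (upTo (suc k)) (const true) (λ i → p i * q (k ∸ i)) (λ i → p i * s (k ∸ i)))

  *ₚ-distribʳ : ∀ p q s → (q +ₚ s) *ₚ p ≈ₚ q *ₚ p +ₚ s *ₚ p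
  *ₚ-distribʳ p q s k = trans (Σℤ-cong (upTo (suc k)) (const true) (λ i _ _ → ℤ.*-distribʳ-+ (p (k ∸ i)) (q i) (s i)))
                              (Σℤ-+ (upTo (suc k)) (const true) (λ i → q i * p (k ∸ i)) (λ i → s i * p (k ∸ i)))

  ·ₚ-*ₚ : ∀ c p q → (c ·ₚ p) *ₚ q ≈ₚ c ·ₚ (p *ₚ q)
  ·ₚ-*ₚ c p q k = trans (Σℤ-cong (upTo (suc k)) (const true) (λ i _ _ → ℤ.*-assoc c (p i) (q (k ∸ i))))
                        (sym (Σℤ-*ˡ (upTo (suc k)) (const true) c (λ i → p i * q (k ∸ i))))

  *ₚ-·ₚ : ∀ c p q → p *ₚ (c ·ₚ q) ≈ₚ c ·ₚ (p *ₚ q)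
  *ₚ-·ₚ c p q k = trans (Σℤ-cong (upTo (suc k)) (const true) (λ i _ _ → reorder (p i) c (q (k ∸ i))))
                        (sym (Σℤ-*ˡ (upTo (suc k)) (const true) c (λ i → p i * q (k ∸ i))))
    where
      reorder : ∀ x c y → x * (c * y) ≡ c * (x * y)
      reorder = solve-∀

  -ₚ-*ₚ : ∀ p q → (-ₚ p) *ₚ q ≈ₚ -ₚ (p *ₚ q)
  -ₚ-*ₚ p q k = trans (Σℤ-cong (upTo (suc k)) (const true) (λ i _ _ → sym (ℤ.neg-distribˡ-* (p i) (q (k ∸ i)))))
                      (Σℤ-neg (upTo (suc k)) (const true) (λ i → p i * q (k ∸ i)))

  *ₚ--ₚ : ∀ p q → p *ₚ (-ₚ q) ≈ₚ -ₚ (p *ₚ q)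
  *ₚ--ₚ p q k = trans (Σℤ-cong (upTo (suc k)) (const true) (λ i _ _ → sym (ℤ.neg-distribʳ-* (p i) (q (k ∸ i)))))
                      (Σℤ-neg (upTo (suc k)) (const true) (λ i → p i * q (k ∸ i)))

  *ₚ-zeroˡ : ∀ q → 0ₚ *ₚ q ≈ₚ 0ₚ
  *ₚ-zeroˡ q k = Σℤ-zero (upTo (suc k)) (const true) (λ i → 0ℤ * q (k ∸ i)) (λ i _ _ → ℤ.*-zeroˡ (q (k ∸ i)))

  *ₚ-zeroʳ : ∀ p → p *ₚ 0ₚ ≈ₚ 0ₚ
  *ₚ-zeroʳ p k = Σℤ-zero (upTo (suc k)) (const true) (λ i → p i * 0ℤ) (λ i _ _ → ℤ.*-zeroʳ (p i))

  *ₚ-vanishesˡ : ∀ {p} q → p ≈ₚ 0ₚ → p *ₚ q ≈ₚ 0ₚ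
  *ₚ-vanishesˡ q p≈0 = ≈ₚ-trans (*ₚ-cong p≈0 (≈ₚ-refl {q})) (*ₚ-zeroˡ q)

  *ₚ-vanishesʳ : ∀ p {q} → q ≈ₚ 0ₚ → p *ₚ q ≈ₚ 0ₚ
  *ₚ-vanishesʳ p q≈0 = ≈ₚ-trans (*ₚ-cong (≈ₚ-refl {p}) q≈0) (*ₚ-zeroʳ p)

  *ₚ-constˡ : ∀ {p} q → (∀ k → p (suc k) ≡ 0ℤ) → p *ₚ q ≈ₚ p 0 ·ₚ q
  *ₚ-constˡ {p} q p-const zero    = *ₚ-coeff₀ p q
  *ₚ-constˡ {p} q p-const (suc k) = trans (*ₚ-shiftˡ p q k) (trans (cong (p 0 * q (suc k) +_) shift-p*q≡0) (ℤ.+-identityʳ _))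
    where
      shift-p*q≡0 : (shift p *ₚ q) k ≡ 0ℤ
      shift-p*q≡0 = *ₚ-vanishesˡ q p-const k

  *ₚ-identityˡ : ∀ q → 1ₚ *ₚ q ≈ₚ q
  *ₚ-identityˡ q k = trans (*ₚ-constˡ {1ₚ} q (λ _ → refl) k) (ℤ.*-identityˡ (q k))

  *ₚ-identityʳ : ∀ p → p *ₚ 1ₚ ≈ₚ p
  *ₚ-identityʳ p k = trans (*ₚ-comm p 1ₚ k) (*ₚ-identityˡ p k)

  *ₚ-assoc : ∀ p q s → (p *ₚ q) *ₚ s ≈ₚ p *ₚ (q *ₚ s)
  *ₚ-assoc p q s zero    = cong (_+ 0ℤ) (begin
    (p *ₚ q) 0 * s 0     ≡⟨ cong (_* s 0) (*ₚ-coeff₀ p q) ⟩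
    p 0 * q 0 * s 0      ≡⟨ ℤ.*-assoc (p 0) (q 0) (s 0) ⟩
    p 0 * (q 0 * s 0)    ≡⟨ cong (p 0 *_) (*ₚ-coeff₀ q s) ⟨
    p 0 * (q *ₚ s) 0     ∎)
    where open ≡-Reasoning
  *ₚ-assoc p q s (suc k) = begin
    ((p *ₚ q) *ₚ s) (suc k)
      ≡⟨ *ₚ-shiftˡ (p *ₚ q) s k ⟩
    (p *ₚ q) 0 * s (suc k) + (shift (p *ₚ q) *ₚ s) k
      ≡⟨ cong₂ _+_ (cong (_* s (suc k)) (*ₚ-coeff₀ p q)) (*ₚ-cong (*ₚ-shiftˡ p q) (≈ₚ-refl {s}) k) ⟩
    p 0 * q 0 * s (suc k) + ((p 0 ·ₚ shift q +ₚ shift p *ₚ q) *ₚ s) k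
      ≡⟨ cong (p 0 * q 0 * s (suc k) +_) (trans (*ₚ-distribʳ s (p 0 ·ₚ shift q) (shift p *ₚ q) k)
           (cong₂ _+_ (·ₚ-*ₚ (p 0) (shift q) s k) (*ₚ-assoc (shift p) q s k))) ⟩
    p 0 * q 0 * s (suc k) + (p 0 * (shift q *ₚ s) k + (shift p *ₚ (q *ₚ s)) k)
      ≡⟨ regroup (p 0) (q 0) (s (suc k)) _ _ ⟩
    p 0 * (q 0 * s (suc k) + (shift q *ₚ s) k) + (shift p *ₚ (q *ₚ s)) k
      ≡⟨ cong (λ x → p 0 * x + (shift p *ₚ (q *ₚ s)) k) (*ₚ-shiftˡ q s k) ⟨
    p 0 * (q *ₚ s) (suc k) + (shift p *ₚ (q *ₚ s)) k
      ≡⟨ *ₚ-shiftˡ p (q *ₚ s) k ⟨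
    (p *ₚ (q *ₚ s)) (suc k) ∎
    where
      open ≡-Reasoning
      regroup : ∀ a b c x y → a * b * c + (a * x + y) ≡ a * (b * c + x) + y
      regroup = solve-∀

  Σₚ-*ₚ : ∀ (l : List A) b (F : A → Poly) q → Σₚ l b F *ₚ q ≈ₚ Σₚ l b (λ a → F a *ₚ q)
  Σₚ-*ₚ l b F q k = trans (Σℤ-cong (upTo (suc k)) (const true) (λ i _ _ → Σℤ-*ʳ l b (q (k ∸ i)) (λ a → F a i)))
    (Σℤ-swap (upTo (suc k)) l {c = λ _ → b} {c′ = λ _ _ → true} (λ i a → F a i * q (k ∸ i))
             (λ _ a → mk⇔ (subst T (sym (∧-identityʳ (b a)))) (subst T (∧-identityʳ (b a)))))

  *ₚ-Σₚ : ∀ (l : List A) b (F : A → Poly) q → q *ₚ Σₚ l b F ≈ₚ Σₚ l b (λ a → q *ₚ F a)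
  *ₚ-Σₚ l b F q k = trans (*ₚ-comm q (Σₚ l b F) k)
    (trans (Σₚ-*ₚ l b F q k) (Σℤ-cong l b (λ a _ _ → *ₚ-comm (F a) q k)))

  rev-≤ : ∀ {n k} p → k ≤ n → rev n p k ≡ p (n ∸ k)
  rev-≤ {n} {k} p k≤n rewrite dec-true (k ≤? n) k≤n = refl

  rev-> : ∀ {n k} p → n < k → rev n p k ≡ 0ℤ
  rev-> {n} {k} p n<k rewrite dec-false (k ≤? n) (ℕ.<⇒≱ n<k) = refl

  rev-cong : ∀ n {p q} → p ≈ₚ q → rev n p ≈ₚ rev n q
  rev-cong n p≈q k with does (k ≤? n)
  ... | true  = p≈q (n ∸ k)
  ... | false = refl

  rev-+ₚ : ∀ n p q → rev n (p +ₚ q) ≈ₚ rev n p +ₚ rev n q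
  rev-+ₚ n p q k with does (k ≤? n)
  ... | true  = refl
  ... | false = refl

  rev-·ₚ : ∀ n c p → rev n (c ·ₚ p) ≈ₚ c ·ₚ rev n p
  rev-·ₚ n c p k with does (k ≤? n)
  ... | true  = refl
  ... | false = sym (ℤ.*-zeroʳ c)

  rev--ₚ : ∀ n p → rev n (-ₚ p) ≈ₚ -ₚ rev n p
  rev--ₚ n p k with does (k ≤? n)
  ... | true  = refl
  ... | false = refl

  rev-0ₚ : ∀ n → rev n 0ₚ ≈ₚ 0ₚ
  rev-0ₚ n k with does (k ≤? n)
  ... | true  = refl
  ... | false = refl

  rev-Σₚ : ∀ n (l : List A) b (F : A → Poly) → rev n (Σₚ l b F) ≈ₚ Σₚ l b (λ a → rev n (F a))
  rev-Σₚ n l b F k with does (k ≤? n)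
  ... | true  = refl
  ... | false = sym (Σℤ-zero l b (λ _ → 0ℤ) (λ _ _ _ → refl))

  infix 8 t^_
  t^_ : ℕ → Poly
  (t^ zero)  = 1ₚ
  (t^ suc n) zero    = 0ℤ
  (t^ suc n) (suc k) = (t^ n) k

  t^-≢ : ∀ {n k} → k ≢ n → (t^ n) k ≡ 0ℤ
  t^-≢ {zero}  {zero}  k≢n = ⊥-elim (k≢n refl)
  t^-≢ {zero}  {suc k} k≢n = refl
  t^-≢ {suc n} {zero}  k≢n = refl
  t^-≢ {suc n} {suc k} k≢n = t^-≢ (k≢n ∘ cong suc)

  t^-≡ : ∀ n → (t^ n) n ≡ 1ℤ
  t^-≡ zero    = refl
  t^-≡ (suc n) = t^-≡ n

  t^-*ₚ-+ : ∀ n u j → (t^ n *ₚ u) (n ℕ.+ j) ≡ u j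
  t^-*ₚ-+ zero    u j = *ₚ-identityˡ u j
  t^-*ₚ-+ (suc n) u j = trans (*ₚ-shiftˡ (t^ suc n) u (n ℕ.+ j))
                               (trans (cong (_+ (t^ n *ₚ u) (n ℕ.+ j)) (ℤ.*-zeroˡ (u (suc (n ℕ.+ j)))))
                                      (trans (ℤ.+-identityˡ _) (t^-*ₚ-+ n u j)))

  t^-*ₚ-< : ∀ n u {k} → k < n → (t^ n *ₚ u) k ≡ 0ℤ
  t^-*ₚ-< (suc n) u {zero}  _         = *ₚ-coeff₀ (t^ suc n) u
  t^-*ₚ-< (suc n) u {suc k} (s≤s k<n) = trans (*ₚ-shiftˡ (t^ suc n) u k)
                                             (trans (cong (_+ (t^ n *ₚ u) k) (ℤ.*-zeroˡ (u (suc k))))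
                                                    (trans (ℤ.+-identityˡ _) (t^-*ₚ-< n u k<n)))

  private
    rev-+-index : ∀ a n p k → rev (a ℕ.+ n) p (a ℕ.+ k) ≡ rev n p k
    rev-+-index a n p k with k ≤? n
    ... | yes k≤n = trans (rev-≤ p (ℕ.+-monoʳ-≤ a k≤n))
                          (trans (cong p (ℕ.[m+n]∸[m+o]≡n∸o a n k)) (sym (rev-≤ p k≤n)))
    ... | no  k≰n = trans (rev-> p (ℕ.+-monoʳ-< a n<k)) (sym (rev-> p n<k))
      where n<k = ℕ.≰⇒> k≰n

  rev-+-DegLe : ∀ a {b q} → DegLe b q → rev (a ℕ.+ b) q ≈ₚ t^ a *ₚ rev b q
  rev-+-DegLe a {b} {q} deg-q k with k ℕ.<? a
  ... | yes k<a = trans (rev-≤ q k≤a+b) (trans (deg-q _ b<a+b∸k) (sym (t^-*ₚ-< a (rev b q) k<a)))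
    where
      k≤a+b : k ≤ a ℕ.+ b
      k≤a+b = ℕ.≤-trans (ℕ.<⇒≤ k<a) (ℕ.m≤m+n a b)
      b<a+b∸k : b < a ℕ.+ b ∸ k
      b<a+b∸k = subst (b <_) (sym (ℕ.+-∸-comm b (ℕ.<⇒≤ k<a))) (ℕ.m<n+m b (ℕ.m<n⇒0<n∸m k<a))
  ... | no  k≮a = subst (λ k → rev (a ℕ.+ b) q k ≡ (t^ a *ₚ rev b q) k) (ℕ.m+[n∸m]≡n (ℕ.≮⇒≥ k≮a))
                        (trans (rev-+-index a b q (k ∸ a)) (sym (t^-*ₚ-+ a (rev b q) (k ∸ a))))

  rev-suc : ∀ a p → rev (suc a) p ≈ₚ rev a (shift p) +ₚ p 0 ·ₚ t^ suc a
  rev-suc a p k with ℕ.<-cmp k (suc a)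
  ... | tri< k<1+a _ _ = begin
    rev (suc a) p k                       ≡⟨ rev-≤ p (ℕ.<⇒≤ k<1+a) ⟩
    p (suc a ∸ k)                         ≡⟨ cong p (ℕ.+-∸-assoc 1 k≤a) ⟩
    p (suc (a ∸ k))                       ≡⟨ rev-≤ (shift p) k≤a ⟨
    rev a (shift p) k                     ≡⟨ ℤ.+-identityʳ _ ⟨
    rev a (shift p) k + 0ℤ                ≡⟨ cong (rev a (shift p) k +_) no-monomial ⟨
    rev a (shift p) k + p 0 * (t^ suc a) k ∎
    where
      open ≡-Reasoning
      k≤a = ℕ.≤-pred k<1+a
      no-monomial = trans (cong (p 0 *_) (t^-≢ (ℕ.<⇒≢ k<1+a))) (ℤ.*-zeroʳ (p 0))
  ... | tri≈ _ refl _ = begin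
    rev (suc a) p (suc a)                 ≡⟨ rev-≤ p (ℕ.≤-refl {suc a}) ⟩
    p (a ∸ a)                             ≡⟨ cong p (ℕ.n∸n≡0 a) ⟩
    p 0                                   ≡⟨ ℤ.*-identityʳ (p 0) ⟨
    p 0 * 1ℤ                              ≡⟨ cong (p 0 *_) (t^-≡ (suc a)) ⟨
    p 0 * (t^ suc a) (suc a)              ≡⟨ ℤ.+-identityˡ _ ⟨
    0ℤ + p 0 * (t^ suc a) (suc a)         ≡⟨ cong (_+ p 0 * (t^ suc a) (suc a)) (rev-> (shift p) (ℕ.n<1+n a)) ⟨
    rev a (shift p) (suc a) + p 0 * (t^ suc a) (suc a) ∎
    where open ≡-Reasoning
  ... | tri> _ _ 1+a<k = begin
    rev (suc a) p k                       ≡⟨ rev-> p 1+a<k ⟩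
    0ℤ                                    ≡⟨ cong₂ _+_ (rev-> (shift p) (ℕ.<-trans (ℕ.n<1+n a) 1+a<k))
                                                       (trans (cong (p 0 *_) (t^-≢ (ℕ.>⇒≢ 1+a<k))) (ℤ.*-zeroʳ (p 0))) ⟨
    rev a (shift p) k + p 0 * (t^ suc a) k ∎
    where open ≡-Reasoning

  rev-suc-*ₚ : ∀ n p q → rev (suc n) (p *ₚ q) ≈ₚ rev n (shift p *ₚ q) +ₚ p 0 ·ₚ rev (suc n) q
  rev-suc-*ₚ n p q k with ℕ.<-cmp k (suc n)
  ... | tri< k<1+n _ _ = begin
    rev (suc n) (p *ₚ q) k                              ≡⟨ rev-≤ (p *ₚ q) (ℕ.<⇒≤ k<1+n) ⟩
    (p *ₚ q) (suc n ∸ k)                                ≡⟨ cong (p *ₚ q) 1+n∸k ⟩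
    (p *ₚ q) (suc (n ∸ k))                              ≡⟨ *ₚ-shiftˡ p q (n ∸ k) ⟩
    p 0 * q (suc (n ∸ k)) + (shift p *ₚ q) (n ∸ k)      ≡⟨ ℤ.+-comm (p 0 * q (suc (n ∸ k))) ((shift p *ₚ q) (n ∸ k)) ⟩
    (shift p *ₚ q) (n ∸ k) + p 0 * q (suc (n ∸ k))      ≡⟨ cong₂ (λ x y → x + p 0 * y) (rev-≤ (shift p *ₚ q) k≤n)
                                                                 (trans (rev-≤ q (ℕ.<⇒≤ k<1+n)) (cong q 1+n∸k)) ⟨
    rev n (shift p *ₚ q) k + p 0 * rev (suc n) q k      ∎
    where
      open ≡-Reasoning
      k≤n = ℕ.≤-pred k<1+n
      1+n∸k : suc n ∸ k ≡ suc (n ∸ k)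
      1+n∸k = ℕ.+-∸-assoc 1 k≤n
  ... | tri≈ _ refl _ = begin
    rev (suc n) (p *ₚ q) (suc n)                        ≡⟨ rev-≤ (p *ₚ q) (ℕ.≤-refl {suc n}) ⟩
    (p *ₚ q) (n ∸ n)                                    ≡⟨ cong (p *ₚ q) (ℕ.n∸n≡0 n) ⟩
    (p *ₚ q) 0                                          ≡⟨ *ₚ-coeff₀ p q ⟩
    p 0 * q 0                                           ≡⟨ cong (λ j → p 0 * q j) (ℕ.n∸n≡0 n) ⟨
    p 0 * q (n ∸ n)                                     ≡⟨ ℤ.+-identityˡ _ ⟨
    0ℤ + p 0 * q (n ∸ n)                                ≡⟨ cong₂ (λ x y → x + p 0 * y) (rev-> (shift p *ₚ q) (ℕ.n<1+n n))
                                                                                        (rev-≤ q (ℕ.≤-refl {suc n})) ⟨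
    rev n (shift p *ₚ q) (suc n) + p 0 * rev (suc n) q (suc n) ∎
    where open ≡-Reasoning
  ... | tri> _ _ 1+n<k = begin
    rev (suc n) (p *ₚ q) k                              ≡⟨ rev-> (p *ₚ q) 1+n<k ⟩
    0ℤ                                                  ≡⟨ cong₂ _+_ (rev-> (shift p *ₚ q) (ℕ.<-trans (ℕ.n<1+n n) 1+n<k))
                                                                   (trans (cong (p 0 *_) (rev-> q 1+n<k)) (ℤ.*-zeroʳ (p 0))) ⟨
    rev n (shift p *ₚ q) k + p 0 * rev (suc n) q k      ∎
    where open ≡-Reasoning

  rev-*ₚ : ∀ a b {p q} → DegLe a p → DegLe b q → rev (a ℕ.+ b) (p *ₚ q) ≈ₚ rev a p *ₚ rev b q
  rev-*ₚ zero b {p} {q} deg-p deg-q = begin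
    rev b (p *ₚ q)          ≈⟨ rev-cong b (*ₚ-constˡ {p} q (λ k → deg-p (suc k) (s≤s ℕ.z≤n))) ⟩
    rev b (p 0 ·ₚ q)        ≈⟨ rev-·ₚ b (p 0) q ⟩
    p 0 ·ₚ rev b q          ≈⟨ *ₚ-constˡ {rev 0 p} (rev b q) (λ _ → refl) ⟨
    rev 0 p *ₚ rev b q      ∎
    where open ≈ₚ-Reasoning
  rev-*ₚ (suc a) b {p} {q} deg-p deg-q = begin
    rev (suc (a ℕ.+ b)) (p *ₚ q)
      ≈⟨ rev-suc-*ₚ (a ℕ.+ b) p q ⟩
    rev (a ℕ.+ b) (shift p *ₚ q) +ₚ p 0 ·ₚ rev (suc a ℕ.+ b) q
      ≈⟨ (λ k → cong₂ _+_ (rev-*ₚ a b (λ k a<k → deg-p (suc k) (s≤s a<k)) deg-q k)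
                           (cong (p 0 *_) (rev-+-DegLe (suc a) deg-q k))) ⟩
    rev a (shift p) *ₚ rev b q +ₚ p 0 ·ₚ (t^ suc a *ₚ rev b q)
      ≈⟨ (λ k → cong ((rev a (shift p) *ₚ rev b q) k +_) (·ₚ-*ₚ (p 0) (t^ suc a) (rev b q) k)) ⟨
    rev a (shift p) *ₚ rev b q +ₚ (p 0 ·ₚ t^ suc a) *ₚ rev b q
      ≈⟨ *ₚ-distribʳ (rev b q) (rev a (shift p)) (p 0 ·ₚ t^ suc a) ⟨
    (rev a (shift p) +ₚ p 0 ·ₚ t^ suc a) *ₚ rev b q
      ≈⟨ *ₚ-cong (rev-suc a p) (≈ₚ-refl {rev b q}) ⟨
    rev (suc a) p *ₚ rev b q ∎
    where open ≈ₚ-Reasoning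

  DegLeHalf : ℕ → Poly → Set
  DegLeHalf r p = ∀ k → r < k ℕ.+ k → p k ≡ 0ℤ

  DegLtHalf⇒DegLeHalf : ∀ {r p} → DegLtHalf r p → DegLeHalf r p
  DegLtHalf⇒DegLeHalf small k r<k+k = small k (ℕ.<⇒≤ r<k+k)

  DegLe-cong : ∀ {r p q} → p ≈ₚ q → DegLe r p → DegLe r q
  DegLe-cong p≈q deg-p k r<k = trans (sym (p≈q k)) (deg-p k r<k)

  DegLtHalf-cong : ∀ {r p q} → p ≈ₚ q → DegLtHalf r p → DegLtHalf r q
  DegLtHalf-cong p≈q small k r≤k+k = trans (sym (p≈q k)) (small k r≤k+k)

  DegLe-·ₚ : ∀ {r} c {p} → DegLe r p → DegLe r (c ·ₚ p)
  DegLe-·ₚ c deg-p k r<k = trans (cong (c *_) (deg-p k r<k)) (ℤ.*-zeroʳ c)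

  DegLtHalf-·ₚ : ∀ {r} c {p} → DegLtHalf r p → DegLtHalf r (c ·ₚ p)
  DegLtHalf-·ₚ c small k r≤k+k = trans (cong (c *_) (small k r≤k+k)) (ℤ.*-zeroʳ c)

  DegLtHalf-+ₚ : ∀ {r p q} → DegLtHalf r p → DegLtHalf r q → DegLtHalf r (p +ₚ q)
  DegLtHalf-+ₚ small-p small-q k r≤k+k = cong₂ _+_ (small-p k r≤k+k) (small-q k r≤k+k)

  DegLtHalf--ₚ : ∀ {r p} → DegLtHalf r p → DegLtHalf r (-ₚ p)
  DegLtHalf--ₚ small k r≤k+k = cong -_ (small k r≤k+k)

  DegLe-Σₚ : ∀ {r} (l : List A) b (F : A → Poly) →
             (∀ a → a ∈ l → T (b a) → DegLe r (F a)) → DegLe r (Σₚ l b F)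
  DegLe-Σₚ l b F deg-F k r<k = Σℤ-zero l b (λ a → F a k) (λ a a∈l ba → deg-F a a∈l ba k r<k)

  DegLtHalf-Σₚ : ∀ {r} (l : List A) b (F : A → Poly) →
                 (∀ a → a ∈ l → T (b a) → DegLtHalf r (F a)) → DegLtHalf r (Σₚ l b F)
  DegLtHalf-Σₚ l b F small-F k r≤k+k = Σℤ-zero l b (λ a → F a k) (λ a a∈l ba → small-F a a∈l ba k r≤k+k)

  *ₚ-coeff-zero : ∀ p q k → (∀ i j → i ℕ.+ j ≡ k → p i ≡ 0ℤ ⊎ q j ≡ 0ℤ) → (p *ₚ q) k ≡ 0ℤ
  *ₚ-coeff-zero p q k some-factor-zero = Σℤ-zero (upTo (suc k)) (const true) (λ i → p i * q (k ∸ i)) λ i i∈ _ →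
    [ (λ pᵢ≡0 → trans (cong (_* q (k ∸ i)) pᵢ≡0) (ℤ.*-zeroˡ (q (k ∸ i))))
    , (λ qⱼ≡0 → trans (cong (p i *_) qⱼ≡0) (ℤ.*-zeroʳ (p i))) ]′
    (some-factor-zero i (k ∸ i) (ℕ.m+[n∸m]≡n (ℕ.≤-pred (∈-upTo⁻ i∈))))

  DegLe-*ₚ : ∀ {a b p q} → DegLe a p → DegLe b q → DegLe (a ℕ.+ b) (p *ₚ q)
  DegLe-*ₚ {a} {b} {p} {q} deg-p deg-q k a+b<k = *ₚ-coeff-zero p q k factor-zero
    where
      factor-zero : ∀ i j → i ℕ.+ j ≡ k → p i ≡ 0ℤ ⊎ q j ≡ 0ℤ
      factor-zero i j i+j≡k with i ≤? a | j ≤? b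
      ... | no  i≰a | _       = inj₁ (deg-p i (ℕ.≰⇒> i≰a))
      ... | yes _   | no  j≰b = inj₂ (deg-q j (ℕ.≰⇒> j≰b))
      ... | yes i≤a | yes j≤b = ⊥-elim (ℕ.<⇒≱ a+b<k (subst (_≤ a ℕ.+ b) i+j≡k (ℕ.+-mono-≤ i≤a j≤b)))

  DegLtHalf-*ₚ : ∀ {a b p q} → DegLtHalf a p → DegLeHalf b q → DegLtHalf (a ℕ.+ b) (p *ₚ q)
  DegLtHalf-*ₚ {a} {b} {p} {q} small-p small-q k a+b≤k+k = *ₚ-coeff-zero p q k factor-zero
    where
      double-+ : ∀ i j → (i ℕ.+ i) ℕ.+ (j ℕ.+ j) ≡ (i ℕ.+ j) ℕ.+ (i ℕ.+ j)
      double-+ = ℕ-Solver.solve-∀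
      factor-zero : ∀ i j → i ℕ.+ j ≡ k → p i ≡ 0ℤ ⊎ q j ≡ 0ℤ
      factor-zero i j refl with a ≤? i ℕ.+ i | b ℕ.<? j ℕ.+ j
      ... | yes a≤2i | _       = inj₁ (small-p i a≤2i)
      ... | no  _    | yes b<2j = inj₂ (small-q j b<2j)
      ... | no  a≰2i | no  b≮2j = ⊥-elim (ℕ.<⇒≱ (ℕ.+-mono-<-≤ (ℕ.≰⇒> a≰2i) (ℕ.≮⇒≥ b≮2j))
                                                  (subst (a ℕ.+ b ≤_) (sym (double-+ i j)) a+b≤k+k))

  DegLe0-*ₚ : ∀ {b p q} → DegLe 0 p → DegLtHalf b q → DegLtHalf b (p *ₚ q)
  DegLe0-*ₚ {p = p} {q} deg-p small-q =
    DegLtHalf-cong (≈ₚ-sym (*ₚ-constˡ {p} q (λ k → deg-p (suc k) (s≤s ℕ.z≤n)))) (DegLtHalf-·ₚ (p 0) small-q)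

  rev-invariant⇒0 : ∀ n {p} → rev n p ≈ₚ p → DegLtHalf n p → p ≈ₚ 0ₚ
  rev-invariant⇒0 n {p} rev-p≈p small k with n ≤? k ℕ.+ k
  ... | yes n≤k+k = small k n≤k+k
  ... | no  n≰k+k = trans (sym (rev-p≈p k)) (trans (rev-≤ p k≤n) (small (n ∸ k) n≤2[n∸k]))
    where
      k+k<n = ℕ.≰⇒> n≰k+k
      k≤n   = ℕ.≤-trans (ℕ.m≤m+n k k) (ℕ.<⇒≤ k+k<n)
      n≤2[n∸k] : n ≤ (n ∸ k) ℕ.+ (n ∸ k)
      n≤2[n∸k] = subst (_≤ (n ∸ k) ℕ.+ (n ∸ k)) (ℕ.m∸n+n≡m k≤n)
                   (ℕ.+-monoʳ-≤ (n ∸ k) (ℕ.m+n≤o⇒m≤o∸n k (ℕ.<⇒≤ k+k<n)))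

  t-1ₚ-*ₚ-coeff₀ : ∀ p → (t-1ₚ *ₚ p) 0 ≡ - p 0
  t-1ₚ-*ₚ-coeff₀ p = trans (*ₚ-coeff₀ t-1ₚ p) (ℤ.-1*i≡-i (p 0))

  t-1ₚ-*ₚ-coeff-suc : ∀ p k → (t-1ₚ *ₚ p) (suc k) ≡ p k ℤ.- p (suc k)
  t-1ₚ-*ₚ-coeff-suc p k = begin
    (t-1ₚ *ₚ p) (suc k)                          ≡⟨ *ₚ-shiftˡ t-1ₚ p k ⟩
    - 1ℤ * p (suc k) + (shift t-1ₚ *ₚ p) k       ≡⟨ cong₂ _+_ (ℤ.-1*i≡-i (p (suc k)))
                                                              (*ₚ-cong shift-t-1≈1 (≈ₚ-refl {p}) k) ⟩
    - p (suc k) + (1ₚ *ₚ p) k                    ≡⟨ cong (- p (suc k) +_) (*ₚ-identityˡ p k) ⟩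
    - p (suc k) + p k                            ≡⟨ ℤ.+-comm (- p (suc k)) (p k) ⟩
    p k ℤ.- p (suc k)                            ∎
    where
      open ≡-Reasoning
      shift-t-1≈1 : shift t-1ₚ ≈ₚ 1ₚ
      shift-t-1≈1 zero    = refl
      shift-t-1≈1 (suc _) = refl

  ≤⌊pred/2⌋⇔ : ∀ {m r} → 0 < r → m ≤ ⌊ r ∸ 1 /2⌋ ⇔ m ℕ.+ m < r
  ≤⌊pred/2⌋⇔ {m} {suc r} _ = mk⇔ (s≤s ∘ ≤⌊/2⌋⇒+≤) (+≤⇒≤⌊/2⌋ ∘ ℕ.≤-pred)
    where
      ≤⌊/2⌋⇒+≤ : m ≤ ⌊ r /2⌋ → m ℕ.+ m ≤ r
      ≤⌊/2⌋⇒+≤ m≤ = ℕ.≤-trans (ℕ.+-mono-≤ m≤ (ℕ.≤-trans m≤ (ℕ.⌊n/2⌋≤⌈n/2⌉ r)))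
                              (ℕ.≤-reflexive (ℕ.⌊n/2⌋+⌈n/2⌉≡n r))
      +≤⇒≤⌊/2⌋ : m ℕ.+ m ≤ r → m ≤ ⌊ r /2⌋
      +≤⇒≤⌊/2⌋ m+m≤r = subst (_≤ ⌊ r /2⌋) (sym (ℕ.n≡⌊n+n/2⌋ m)) (ℕ.⌊n/2⌋-mono m+m≤r)

  LowerHalf : ℕ → Poly → Poly → Set
  LowerHalf r p d = (∀ k → k ℕ.+ k < r → d k ≡ p k) × DegLtHalf r d

  private
    self-neg⇒0 : ∀ x → x ≡ - x → x ≡ 0ℤ
    self-neg⇒0 (ℤ.+ zero)  _  = refl
    self-neg⇒0 ℤ.+[1+ _ ] ()
    self-neg⇒0 ℤ.-[1+ _ ] ()

  rev-lowerHalf : ∀ r {p d} → DegLe r p → rev r p ≈ₚ -ₚ p → LowerHalf r (-ₚ p) d → rev r d ≈ₚ d +ₚ p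
  rev-lowerHalf r {p} {d} deg-p antisym (d≈-p , small-d) k with k ≤? r
  ... | no  k≰r = trans (rev-> d r<k) (sym (cong₂ _+_ (small-d k (ℕ.≤-trans (ℕ.<⇒≤ r<k) (ℕ.m≤m+n k k))) (deg-p k r<k)))
    where r<k = ℕ.≰⇒> k≰r
  ... | yes k≤r = trans (rev-≤ d k≤r) (mirror (k ℕ.+ k ℕ.<? r) (j ℕ.+ j ℕ.<? r))
    where
      j = r ∸ k
      k+j≡r : k ℕ.+ j ≡ r
      k+j≡r = ℕ.m+[n∸m]≡n k≤r
      pⱼ≡-pₖ : p j ≡ - p k
      pⱼ≡-pₖ = trans (sym (rev-≤ p k≤r)) (antisym k)
      mirror : Dec (k ℕ.+ k < r) → Dec (j ℕ.+ j < r) → d j ≡ d k + p k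
      mirror (yes k+k<r) _ = begin
        d j            ≡⟨ small-d j r≤j+j ⟩
        0ℤ             ≡⟨ ℤ.+-inverseˡ (p k) ⟨
        - p k + p k    ≡⟨ cong (_+ p k) (d≈-p k k+k<r) ⟨
        d k + p k      ∎
        where
          open ≡-Reasoning
          k<j = ℕ.+-cancelˡ-< k k j (subst (k ℕ.+ k <_) (sym k+j≡r) k+k<r)
          r≤j+j = subst (_≤ j ℕ.+ j) k+j≡r (ℕ.+-monoˡ-≤ j (ℕ.<⇒≤ k<j))
      mirror (no k+k≮r) (yes j+j<r) = begin
        d j            ≡⟨ d≈-p j j+j<r ⟩
        - p j          ≡⟨ cong -_ pⱼ≡-pₖ ⟩
        - - p k        ≡⟨ ℤ.neg-involutive (p k) ⟩
        p k            ≡⟨ ℤ.+-identityˡ (p k) ⟨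
        0ℤ + p k       ≡⟨ cong (_+ p k) (small-d k (ℕ.≮⇒≥ k+k≮r)) ⟨
        d k + p k      ∎
        where open ≡-Reasoning
      mirror (no k+k≮r) (no j+j≮r) = begin
        d j            ≡⟨ small-d j (ℕ.≮⇒≥ j+j≮r) ⟩
        0ℤ             ≡⟨ cong₂ _+_ (small-d k (ℕ.≮⇒≥ k+k≮r)) pₖ≡0 ⟨
        d k + p k      ∎
        where
          open ≡-Reasoning
          j≤k = ℕ.+-cancelˡ-≤ k j k (subst (_≤ k ℕ.+ k) (sym k+j≡r) (ℕ.≮⇒≥ k+k≮r))
          k≤j = ℕ.+-cancelʳ-≤ j k j (subst (_≤ j ℕ.+ j) (sym k+j≡r) (ℕ.≮⇒≥ j+j≮r))
          pₖ≡0 = self-neg⇒0 (p k) (trans (cong p (ℕ.≤-antisym k≤j j≤k)) pⱼ≡-pₖ)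

  sign-+ : ∀ m n → sign (m ℕ.+ n) ≡ sign m * sign n
  sign-+ zero    n = sym (ℤ.*-identityˡ (sign n))
  sign-+ (suc m) n = trans (cong -_ (sign-+ m n)) (ℤ.neg-distribˡ-* (sign m) (sign n))

  sign-*-sign : ∀ n → sign n * sign n ≡ 1ℤ
  sign-*-sign zero    = refl
  sign-*-sign (suc n) = trans (neg*neg (sign n)) (sign-*-sign n)
    where
      neg*neg : ∀ x → - x * - x ≡ x * x
      neg*neg = solve-∀

  sign-∸ : ∀ {m n} → m ≤ n → sign (n ∸ m) ≡ sign m * sign n
  sign-∸ {m} {n} m≤n = begin
    sign (n ∸ m)                        ≡⟨ ℤ.*-identityˡ _ ⟨
    1ℤ * sign (n ∸ m)                   ≡⟨ cong (_* sign (n ∸ m)) (sign-*-sign m) ⟨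
    sign m * sign m * sign (n ∸ m)      ≡⟨ ℤ.*-assoc (sign m) (sign m) _ ⟩
    sign m * (sign m * sign (n ∸ m))    ≡⟨ cong (sign m *_) (sign-+ m (n ∸ m)) ⟨
    sign m * sign (m ℕ.+ (n ∸ m))       ≡⟨ cong (λ k → sign m * sign k) (ℕ.m+[n∸m]≡n m≤n) ⟩
    sign m * sign n                     ∎
    where open ≡-Reasoning

  DegLe0⇒DegLeHalf0 : ∀ {p} → DegLe 0 p → DegLeHalf 0 p
  DegLe0⇒DegLeHalf0 deg-p zero    ()
  DegLe0⇒DegLeHalf0 deg-p (suc k) _ = deg-p (suc k) (s≤s ℕ.z≤n)

open Polynomials

-- Incidence algebras

module IncidenceAlgebra (P : FinOrd) (P-poset : IsFinPoset P) where

  open FinOrd P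
  open IsFinPoset P-poset

  infix 4 _<ᴾ_
  _<ᴾ_ : Carrier → Carrier → Set
  _<ᴾ_ = _<ₒ_ P

  infixl 7 _⋆_
  _⋆_ : Inc P → Inc P → Inc P
  _⋆_ = _⊛_ P

  1ᴵ : Inc P
  1ᴵ = δ P

  infixl 6 _+ᴵ_
  _+ᴵ_ : Inc P → Inc P → Inc P
  (p +ᴵ q) z z' = p z z' +ₚ q z z'

  -ᴵ_ : Inc P → Inc P
  (-ᴵ p) z z' = -ₚ p z z'

  infixr 7 _·ᴵ_
  _·ᴵ_ : Poly → Inc P → Inc P
  (c ·ᴵ p) z z' = c *ₚ p z z'

  infix 4 _≈ᴵ_
  _≈ᴵ_ : Inc P → Inc P → Set
  p ≈ᴵ q = ∀ z z' → z ≤ z' → p z z' ≈ₚ q z z'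

  ≈ᴵ-setoid : Setoid _ _
  ≈ᴵ-setoid = record
    { Carrier       = Inc P
    ; _≈_           = _≈ᴵ_
    ; isEquivalence = record
      { refl  = λ _ _ _ _ → refl
      ; sym   = λ p≈q z z' z≤z' k → sym (p≈q z z' z≤z' k)
      ; trans = λ p≈q q≈s z z' z≤z' k → trans (p≈q z z' z≤z' k) (q≈s z z' z≤z' k)
      }
    }

  module ≈ᴵ-Reasoning = SetoidReasoning ≈ᴵ-setoid
  open Setoid ≈ᴵ-setoid public
    using () renaming (refl to ≈ᴵ-refl; sym to ≈ᴵ-sym; trans to ≈ᴵ-trans)

  ∈-interval : ∀ {z z' w} → T (inInterval P z z' w) ⇔ (z ≤ w × w ≤ z')
  ∈-interval {z} {z'} {w} = T-does-∧ (z ≤? w) (w ≤? z')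

  1ᴵ-diag : ∀ z → 1ᴵ z z ≡ 1ₚ
  1ᴵ-diag z rewrite dec-true (z ≟ z) refl = refl

  1ᴵ-off-diag : ∀ {z z'} → z ≢ z' → 1ᴵ z z' ≡ 0ₚ
  1ᴵ-off-diag {z} {z'} z≢z' rewrite dec-false (z ≟ z') z≢z' = refl

  diagonal-or-strict : ∀ {z z'} {A : Set} → z ≤ z' → (z ≡ z' → A) → (z <ᴾ z' → A) → A
  diagonal-or-strict {z} {z'} z≤z' on-diagonal strict with z ≟ z'
  ... | yes z≡z' = on-diagonal z≡z'
  ... | no  z≢z' = strict (z≤z' , z≢z')

  ⋆-cong : ∀ {p p′ q q′} → p ≈ᴵ p′ → q ≈ᴵ q′ → p ⋆ q ≈ᴵ p′ ⋆ q′
  ⋆-cong p≈p′ q≈q′ z z' _ k = Σℤ-cong elems (inInterval P z z') λ w _ w∈ →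
    let z≤w , w≤z' = to ∈-interval w∈ in *ₚ-cong (p≈p′ z w z≤w) (q≈q′ w z' w≤z') k

  ⋆-congˡ : ∀ {p p′} q → p ≈ᴵ p′ → p ⋆ q ≈ᴵ p′ ⋆ q
  ⋆-congˡ q p≈p′ = ⋆-cong p≈p′ (≈ᴵ-refl {q})

  ⋆-congʳ : ∀ p {q q′} → q ≈ᴵ q′ → p ⋆ q ≈ᴵ p ⋆ q′
  ⋆-congʳ p q≈q′ = ⋆-cong (≈ᴵ-refl {p}) q≈q′

  ⋆-single-term : ∀ p q {z z'} w → z ≤ w → w ≤ z' →
                  (∀ w′ → z ≤ w′ → w′ ≤ z' → w′ ≢ w → p z w′ *ₚ q w′ z' ≈ₚ 0ₚ) →
                  (p ⋆ q) z z' ≈ₚ p z w *ₚ q w z'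
  ⋆-single-term p q {z} {z'} w z≤w w≤z' others k =
    Σℤ-single (inInterval P z z') (λ w → (p z w *ₚ q w z') k) elems-unique (elems-complete w)
              (from ∈-interval (z≤w , w≤z'))
              (λ w′ w′∈ w′≢w → let z≤w′ , w′≤z' = to ∈-interval w′∈ in others w′ z≤w′ w′≤z' w′≢w k)

  ⋆-vanishes : ∀ p q {z z'} → (∀ w → z ≤ w → w ≤ z' → p z w *ₚ q w z' ≈ₚ 0ₚ) →
               (p ⋆ q) z z' ≈ₚ 0ₚ
  ⋆-vanishes p q {z} {z'} terms-vanish k = Σℤ-zero elems (inInterval P z z') (λ w → (p z w *ₚ q w z') k)
    (λ w _ w∈ → let z≤w , w≤z' = to ∈-interval w∈ in terms-vanish w z≤w w≤z' k)

  ⋆-diag : ∀ p q z → (p ⋆ q) z z ≈ₚ p z z *ₚ q z z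
  ⋆-diag p q z = ⋆-single-term p q z (≤-refl z) (≤-refl z)
    (λ w z≤w w≤z w≢z → ⊥-elim (w≢z (≤-antisym w≤z z≤w)))

  ⋆-identityˡ : ∀ p → 1ᴵ ⋆ p ≈ᴵ p
  ⋆-identityˡ p z z' z≤z' k = trans (⋆-single-term 1ᴵ p z (≤-refl z) z≤z' others k)
    (trans (cong (λ u → (u *ₚ p z z') k) (1ᴵ-diag z)) (*ₚ-identityˡ (p z z') k))
    where
      others : ∀ w → z ≤ w → w ≤ z' → w ≢ z → 1ᴵ z w *ₚ p w z' ≈ₚ 0ₚ
      others w _ _ w≢z k = trans (cong (λ u → (u *ₚ p w z') k) (1ᴵ-off-diag (w≢z ∘ sym)))
                                 (*ₚ-zeroˡ (p w z') k)

  ⋆-identityʳ : ∀ p → p ⋆ 1ᴵ ≈ᴵ p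
  ⋆-identityʳ p z z' z≤z' k = trans (⋆-single-term p 1ᴵ z' z≤z' (≤-refl z') others k)
    (trans (cong (λ u → (p z z' *ₚ u) k) (1ᴵ-diag z')) (*ₚ-identityʳ (p z z') k))
    where
      others : ∀ w → z ≤ w → w ≤ z' → w ≢ z' → p z w *ₚ 1ᴵ w z' ≈ₚ 0ₚ
      others w _ _ w≢z' k = trans (cong (λ u → (p z w *ₚ u) k) (1ᴵ-off-diag w≢z'))
                                  (*ₚ-zeroʳ (p z w) k)

  ⋆-assoc : ∀ p q s → (p ⋆ q) ⋆ s ≈ᴵ p ⋆ (q ⋆ s)
  ⋆-assoc p q s z z' _ k = begin
    ((p ⋆ q) ⋆ s) z z' k
      ≡⟨ Σℤ-cong elems (I z z') (λ w _ _ → Σₚ-*ₚ elems (I z w) (λ v → p z v *ₚ q v w) (s w z') k) ⟩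
    Σℤ elems (I z z') (λ w → Σℤ elems (I z w) (λ v → ((p z v *ₚ q v w) *ₚ s w z') k))
      ≡⟨ Σℤ-swap elems elems (λ w v → ((p z v *ₚ q v w) *ₚ s w z') k) (λ w v → reorder) ⟩
    Σℤ elems (I z z') (λ v → Σℤ elems (I v z') (λ w → ((p z v *ₚ q v w) *ₚ s w z') k))
      ≡⟨ Σℤ-cong elems (I z z') (λ v _ _ → Σℤ-cong elems (I v z') λ w _ _ →
           *ₚ-assoc (p z v) (q v w) (s w z') k) ⟩
    Σℤ elems (I z z') (λ v → Σℤ elems (I v z') (λ w → (p z v *ₚ (q v w *ₚ s w z')) k))
      ≡⟨ Σℤ-cong elems (I z z') (λ v _ _ → *ₚ-Σₚ elems (I v z') (λ w → q v w *ₚ s w z') (p z v) k) ⟨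
    (p ⋆ (q ⋆ s)) z z' k ∎
    where
      open ≡-Reasoning
      I = inInterval P
      ∈-intervals : ∀ {a b c a′ b′ c′} →
                    T (I a b c ∧ I a′ b′ c′) ⇔ ((a ≤ c × c ≤ b) × (a′ ≤ c′ × c′ ≤ b′))
      ∈-intervals = T-∧⇔ ∈-interval ∈-interval
      reorder : ∀ {w v} → T (I z z' w ∧ I z w v) ⇔ T (I z z' v ∧ I v z' w)
      reorder = mk⇔
        (λ t → let (z≤w , w≤z') , (z≤v , v≤w) = to ∈-intervals t
               in from ∈-intervals ((z≤v , ≤-trans v≤w w≤z') , (v≤w , w≤z')))
        (λ t → let (z≤v , v≤z') , (v≤w , w≤z') = to ∈-intervals t
               in from ∈-intervals ((≤-trans z≤v v≤w , w≤z') , (z≤v , v≤w)))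

  ⋆-distribˡ : ∀ p q s → p ⋆ (q +ᴵ s) ≈ᴵ p ⋆ q +ᴵ p ⋆ s
  ⋆-distribˡ p q s z z' _ k =
    trans (Σℤ-cong elems (inInterval P z z') (λ w _ _ → *ₚ-distribˡ (p z w) (q w z') (s w z') k))
          (Σℤ-+ elems (inInterval P z z') (λ w → (p z w *ₚ q w z') k) (λ w → (p z w *ₚ s w z') k))

  ⋆-distribʳ : ∀ p q s → (q +ᴵ s) ⋆ p ≈ᴵ q ⋆ p +ᴵ s ⋆ p
  ⋆-distribʳ p q s z z' _ k =
    trans (Σℤ-cong elems (inInterval P z z') (λ w _ _ → *ₚ-distribʳ (p w z') (q z w) (s z w) k))
          (Σℤ-+ elems (inInterval P z z') (λ w → (q z w *ₚ p w z') k) (λ w → (s z w *ₚ p w z') k))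

  ⋆-negˡ : ∀ p q → (-ᴵ p) ⋆ q ≈ᴵ -ᴵ (p ⋆ q)
  ⋆-negˡ p q z z' _ k =
    trans (Σℤ-cong elems (inInterval P z z') (λ w _ _ → -ₚ-*ₚ (p z w) (q w z') k))
          (Σℤ-neg elems (inInterval P z z') (λ w → (p z w *ₚ q w z') k))

  ⋆-negʳ : ∀ p q → p ⋆ (-ᴵ q) ≈ᴵ -ᴵ (p ⋆ q)
  ⋆-negʳ p q z z' _ k =
    trans (Σℤ-cong elems (inInterval P z z') (λ w _ _ → *ₚ--ₚ (p z w) (q w z') k))
          (Σℤ-neg elems (inInterval P z z') (λ w → (p z w *ₚ q w z') k))

  ·ᴵ-⋆ : ∀ c p q → c ·ᴵ (p ⋆ q) ≈ᴵ (c ·ᴵ p) ⋆ q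
  ·ᴵ-⋆ c p q z z' _ k =
    trans (*ₚ-Σₚ elems (inInterval P z z') (λ w → p z w *ₚ q w z') c k)
          (Σℤ-cong elems (inInterval P z z') (λ w _ _ → sym (*ₚ-assoc c (p z w) (q w z') k)))

  +ᴵ-cong : ∀ {p p′ q q′} → p ≈ᴵ p′ → q ≈ᴵ q′ → p +ᴵ q ≈ᴵ p′ +ᴵ q′
  +ᴵ-cong p≈p′ q≈q′ z z' z≤z' = +ₚ-cong (p≈p′ z z' z≤z') (q≈q′ z z' z≤z')

  -ᴵ-cong : ∀ {p q} → p ≈ᴵ q → -ᴵ p ≈ᴵ -ᴵ q
  -ᴵ-cong p≈q z z' z≤z' k = cong -_ (p≈q z z' z≤z' k)

  IsEulerian : (Carrier → ℕ) → Set
  IsEulerian ρ = ∀ z z' → z <ᴾ z' → Σℤ elems (inInterval P z z') (sign ∘ ρ) ≡ 0ℤ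

  module WeakRank (r : Carrier → Carrier → ℕ) (r-weak : IsWeakRank P r) where

    open IsWeakRank r-weak

    revᴵ : Inc P → Inc P
    revᴵ = revI P r

    r-refl : ∀ z → r z z ≡ 0
    r-refl z = ℕ.+-cancelˡ-≡ (r z z) (r z z) 0
      (trans (sym (additive z z z (≤-refl z) (≤-refl z))) (sym (ℕ.+-identityʳ (r z z))))

    r-<ˡ : ∀ {z w z'} → z <ᴾ w → w ≤ z' → r w z' < r z z'
    r-<ˡ {z} {w} {z'} z<w w≤z' = subst (r w z' <_) (sym (additive z w z' (proj₁ z<w) w≤z'))
                                     (ℕ.+-monoˡ-≤ (r w z') (positive z w z<w))

    r-<ʳ : ∀ {z w z'} → z ≤ w → w <ᴾ z' → r z w < r z z'
    r-<ʳ {z} {w} {z'} z≤w w<z' = subst (r z w <_) (sym (additive z w z' z≤w (proj₁ w<z')))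
      (subst (ℕ._≤ r z w ℕ.+ r w z') (ℕ.+-comm (r z w) 1) (ℕ.+-monoʳ-≤ (r z w) (positive w z' w<z')))

    InCalI-cong : ∀ {p q} → p ≈ᴵ q → InCalI P r p → InCalI P r q
    InCalI-cong p≈q p∈𝓘 z z' z≤z' = DegLe-cong (p≈q z z' z≤z') (p∈𝓘 z z' z≤z')

    revᴵ-cong : ∀ {p q} → p ≈ᴵ q → revᴵ p ≈ᴵ revᴵ q
    revᴵ-cong p≈q z z' z≤z' = rev-cong (r z z') (p≈q z z' z≤z')

    revᴵ-⋆ : ∀ {p q} → InCalI P r p → InCalI P r q → revᴵ (p ⋆ q) ≈ᴵ revᴵ p ⋆ revᴵ q
    revᴵ-⋆ {p} {q} p∈𝓘 q∈𝓘 z z' _ k =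
      trans (rev-Σₚ (r z z') elems (inInterval P z z') (λ w → p z w *ₚ q w z') k)
            (Σℤ-cong elems (inInterval P z z') λ w _ w∈ → let z≤w , w≤z' = to ∈-interval w∈ in
              trans (cong (λ n → rev n (p z w *ₚ q w z') k) (additive z w z' z≤w w≤z'))
                    (rev-*ₚ (r z w) (r w z') (p∈𝓘 z w z≤w) (q∈𝓘 w z' w≤z') k))

    InCalI-⋆ : ∀ {p q} → InCalI P r p → InCalI P r q → InCalI P r (p ⋆ q)
    InCalI-⋆ {p} {q} p∈𝓘 q∈𝓘 z z' _ = DegLe-Σₚ elems (inInterval P z z') (λ w → p z w *ₚ q w z')
      λ w _ w∈ → let z≤w , w≤z' = to ∈-interval w∈ in
        subst (λ n → DegLe n (p z w *ₚ q w z')) (sym (additive z w z' z≤w w≤z'))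
              (DegLe-*ₚ (p∈𝓘 z w z≤w) (q∈𝓘 w z' w≤z'))

    LowDegree : Inc P → Set
    LowDegree p = (∀ z z' → z <ᴾ z' → DegLtHalf (r z z') (p z z')) × (∀ z → DegLe 0 (p z z))

    LowDegree-⋆ : ∀ {p q} → LowDegree p → LowDegree q → LowDegree (p ⋆ q)
    LowDegree-⋆ {p} {q} (p-small , p-const) (q-small , q-const) = off-diagonal , diagonal
      where
        q-halved : ∀ w z' → w ≤ z' → DegLeHalf (r w z') (q w z')
        q-halved w z' w≤z' with w ≟ z'
        ... | yes refl = subst (λ n → DegLeHalf n (q w w)) (sym (r-refl w)) (DegLe0⇒DegLeHalf0 (q-const w))
        ... | no  w≢z' = DegLtHalf⇒DegLeHalf (q-small w z' (w≤z' , w≢z'))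
        off-diagonal : ∀ z z' → z <ᴾ z' → DegLtHalf (r z z') ((p ⋆ q) z z')
        off-diagonal z z' z<z' = DegLtHalf-Σₚ elems (inInterval P z z') (λ w → p z w *ₚ q w z') term
          where
            term : ∀ w → _ → T (inInterval P z z' w) → DegLtHalf (r z z') (p z w *ₚ q w z')
            term w _ w∈ with w ≟ z | to ∈-interval w∈
            ... | yes refl | _           = DegLe0-*ₚ (p-const z) (q-small z z' z<z')
            ... | no  w≢z  | z≤w , w≤z' =
              subst (λ n → DegLtHalf n (p z w *ₚ q w z')) (sym (additive z w z' z≤w w≤z'))
                    (DegLtHalf-*ₚ (p-small z w (z≤w , w≢z ∘ sym)) (q-halved w z' w≤z'))
        diagonal : ∀ z → DegLe 0 ((p ⋆ q) z z)
        diagonal z = DegLe-cong (≈ₚ-sym (⋆-diag p q z)) (DegLe-*ₚ (p-const z) (q-const z))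

    revᴵ-invariant⇒1ᴵ : ∀ {p} → revᴵ p ≈ᴵ p → LowDegree p → (∀ z → p z z ≈ₚ 1ₚ) → p ≈ᴵ 1ᴵ
    revᴵ-invariant⇒1ᴵ {p} p-invariant (p-small , _) p-diag z z' z≤z' k with z ≟ z'
    ... | yes refl = p-diag z k
    ... | no  z≢z' = rev-invariant⇒0 (r z z') (p-invariant z z' z≤z') (p-small z z' (z≤z' , z≢z')) k

    Δ-diag : ∀ p z → Δ P r p z z ≈ₚ 0ₚ
    Δ-diag p z k rewrite dec-true (z ≟ z) refl = refl

    Δ-lowerHalf : ∀ p {z z'} → z <ᴾ z' → LowerHalf (r z z') (-ₚ (t-1ₚ *ₚ p z z')) (Δ P r p z z')
    Δ-lowerHalf p {z} {z'} z<z'@(_ , z≢z') = below , above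
      where
        0<r = positive z z' z<z'
        minus-swap : ∀ x y → y ℤ.- x ≡ - (x ℤ.- y)
        minus-swap = solve-∀
        below : ∀ k → k ℕ.+ k < r z z' → Δ P r p z z' k ≡ - (t-1ₚ *ₚ p z z') k
        below zero    _ rewrite dec-false (z ≟ z') z≢z' =
          sym (trans (cong -_ (t-1ₚ-*ₚ-coeff₀ (p z z'))) (ℤ.neg-involutive (p z z' 0)))
        below (suc j) 2k<r
          rewrite dec-false (z ≟ z') z≢z' | dec-true (suc j ℕ.≤? ℕ.⌊ r z z' ∸ 1 /2⌋) (from (≤⌊pred/2⌋⇔ 0<r) 2k<r) =
          trans (minus-swap (p z z' j) (p z z' (suc j))) (cong -_ (sym (t-1ₚ-*ₚ-coeff-suc (p z z') j)))
        above : DegLtHalf (r z z') (Δ P r p z z')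
        above zero    r≤0 = ⊥-elim (ℕ.<⇒≱ 0<r r≤0)
        above (suc j) r≤2k
          rewrite dec-false (z ≟ z') z≢z'
                | dec-false (suc j ℕ.≤? ℕ.⌊ r z z' ∸ 1 /2⌋) (λ le → ℕ.<⇒≱ (to (≤⌊pred/2⌋⇔ 0<r) le) r≤2k) = refl

  module Signed (ρ : Carrier → ℕ) (ρ-mono : ∀ {z z'} → z ≤ z' → ρ z ℕ.≤ ρ z') where

    hat : Inc P → Inc P
    hat = hatI P ρ

    hat-cong : ∀ {p q} → p ≈ᴵ q → hat p ≈ᴵ hat q
    hat-cong p≈q z z' z≤z' k = cong (sign (ρ z' ∸ ρ z) *_) (p≈q z z' z≤z' k)

    hat-involutive : ∀ p → hat (hat p) ≈ᴵ p
    hat-involutive p z z' _ k = begin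
      s * (s * p z z' k)   ≡⟨ ℤ.*-assoc s s (p z z' k) ⟨
      s * s * p z z' k     ≡⟨ cong (_* p z z' k) (sign-*-sign (ρ z' ∸ ρ z)) ⟩
      1ℤ * p z z' k        ≡⟨ ℤ.*-identityˡ (p z z' k) ⟩
      p z z' k             ∎
      where
        open ≡-Reasoning
        s = sign (ρ z' ∸ ρ z)

    hat-diag : ∀ p z → hat p z z ≈ₚ p z z
    hat-diag p z k = trans (cong (λ n → sign n * p z z k) (ℕ.n∸n≡0 (ρ z))) (ℤ.*-identityˡ (p z z k))

    hat-1ᴵ : hat 1ᴵ ≈ᴵ 1ᴵ
    hat-1ᴵ z z' _ k with z ≟ z'
    ... | yes refl = hat-diag (λ _ _ → 1ₚ) z k
    ... | no  _    = ℤ.*-zeroʳ (sign (ρ z' ∸ ρ z))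

    hat-+ᴵ : ∀ p q → hat (p +ᴵ q) ≈ᴵ hat p +ᴵ hat q
    hat-+ᴵ p q z z' _ k = ℤ.*-distribˡ-+ (sign (ρ z' ∸ ρ z)) (p z z' k) (q z z' k)

    hat-revI : ∀ r p → hat (revI P r p) ≈ᴵ revI P r (hat p)
    hat-revI r p z z' _ = ≈ₚ-sym (rev-·ₚ (r z z') (sign (ρ z' ∸ ρ z)) (p z z'))

    InCalI-hat : ∀ {r p} → InCalI P r p → InCalI P r (hat p)
    InCalI-hat p∈𝓘 z z' z≤z' = DegLe-·ₚ (sign (ρ z' ∸ ρ z)) (p∈𝓘 z z' z≤z')

    sign-split : ∀ {z w z'} → z ≤ w → w ≤ z' → sign (ρ z' ∸ ρ z) ≡ sign (ρ w ∸ ρ z) * sign (ρ z' ∸ ρ w)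
    sign-split {z} {w} {z'} z≤w w≤z' = begin
      sign (ρ z' ∸ ρ z)
        ≡⟨ sign-∸ (ρ-mono (≤-trans z≤w w≤z')) ⟩
      sign (ρ z) * sign (ρ z')
        ≡⟨ insert-square (sign (ρ z)) (sign (ρ w)) (sign (ρ z')) (sign-*-sign (ρ w)) ⟩
      sign (ρ z) * sign (ρ w) * (sign (ρ w) * sign (ρ z'))
        ≡⟨ cong₂ _*_ (sign-∸ (ρ-mono z≤w)) (sign-∸ (ρ-mono w≤z')) ⟨
      sign (ρ w ∸ ρ z) * sign (ρ z' ∸ ρ w) ∎
      where
        open ≡-Reasoning
        insert-square : ∀ a b c → b * b ≡ 1ℤ → a * c ≡ a * b * (b * c)
        insert-square a b c b²≡1 = trans (cong (_* c) (sym (ℤ.*-identityʳ a)))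
                                         (trans (cong (λ u → a * u * c) (sym b²≡1)) (reassoc a b c))
          where
            reassoc : ∀ a b c → a * (b * b) * c ≡ a * b * (b * c)
            reassoc = solve-∀

    hat-⋆ : ∀ p q → hat (p ⋆ q) ≈ᴵ hat p ⋆ hat q
    hat-⋆ p q z z' _ k =
      trans (Σℤ-*ˡ elems (inInterval P z z') (sign (ρ z' ∸ ρ z)) (λ w → (p z w *ₚ q w z') k))
            (Σℤ-cong elems (inInterval P z z') λ w _ w∈ → term w (to ∈-interval w∈))
      where
        term : ∀ w → z ≤ w × w ≤ z' → sign (ρ z' ∸ ρ z) * (p z w *ₚ q w z') k ≡ (hat p z w *ₚ hat q w z') k
        term w (z≤w , w≤z') = begin
          sign (ρ z' ∸ ρ z) * (p z w *ₚ q w z') k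
            ≡⟨ cong (_* (p z w *ₚ q w z') k) (sign-split z≤w w≤z') ⟩
          sign (ρ w ∸ ρ z) * sign (ρ z' ∸ ρ w) * (p z w *ₚ q w z') k
            ≡⟨ ℤ.*-assoc (sign (ρ w ∸ ρ z)) _ _ ⟩
          sign (ρ w ∸ ρ z) * (sign (ρ z' ∸ ρ w) * (p z w *ₚ q w z') k)
            ≡⟨ cong (sign (ρ w ∸ ρ z) *_) (*ₚ-·ₚ (sign (ρ z' ∸ ρ w)) (p z w) (q w z') k) ⟨
          sign (ρ w ∸ ρ z) * (p z w *ₚ hat q w z') k
            ≡⟨ ·ₚ-*ₚ (sign (ρ w ∸ ρ z)) (p z w) (hat q w z') k ⟨
          (hat p z w *ₚ hat q w z') k ∎
          where open ≡-Reasoning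

    hat-⋆-inverse : ∀ {p q} → p ⋆ q ≈ᴵ 1ᴵ → hat p ⋆ hat q ≈ᴵ 1ᴵ
    hat-⋆-inverse {p} {q} p⋆q≈1 = ≈ᴵ-trans (≈ᴵ-sym (hat-⋆ p q)) (≈ᴵ-trans (hat-cong p⋆q≈1) hat-1ᴵ)

    module MultiplicativeKernel (κ : Inc P) (κ-diag : ∀ z → κ z z ≈ₚ 1ₚ) (κ-mult : Multiplicative P κ)
                                (eulerian : IsEulerian ρ) where

      hat-κ⋆κ : hat κ ⋆ κ ≈ᴵ 1ᴵ
      hat-κ⋆κ z z' z≤z' k with z ≟ z'
      ... | yes refl = trans (⋆-diag (hat κ) κ z k)
                             (trans (*ₚ-cong (≈ₚ-trans (hat-diag κ z) (κ-diag z)) (κ-diag z) k) (*ₚ-identityˡ 1ₚ k))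
      ... | no  z≢z' = begin
        Σℤ elems (inInterval P z z') (λ w → (hat κ z w *ₚ κ w z') k)
          ≡⟨ Σℤ-cong elems (inInterval P z z') (λ w _ w∈ → term w (to ∈-interval w∈)) ⟩
        Σℤ elems (inInterval P z z') (λ w → sign (ρ w) * (sign (ρ z) * κ z z' k))
          ≡⟨ Σℤ-*ʳ elems (inInterval P z z') (sign (ρ z) * κ z z' k) (sign ∘ ρ) ⟨
        Σℤ elems (inInterval P z z') (sign ∘ ρ) * (sign (ρ z) * κ z z' k)
          ≡⟨ cong (_* (sign (ρ z) * κ z z' k)) (eulerian z z' (z≤z' , z≢z')) ⟩
        0ℤ ∎
        where
          open ≡-Reasoning
          reorder : ∀ a b c → a * b * c ≡ b * (a * c)
          reorder = solve-∀
          term : ∀ w → z ≤ w × w ≤ z' → (hat κ z w *ₚ κ w z') k ≡ sign (ρ w) * (sign (ρ z) * κ z z' k)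
          term w (z≤w , w≤z') = begin
            (hat κ z w *ₚ κ w z') k                     ≡⟨ ·ₚ-*ₚ (sign (ρ w ∸ ρ z)) (κ z w) (κ w z') k ⟩
            sign (ρ w ∸ ρ z) * (κ z w *ₚ κ w z') k      ≡⟨ cong₂ _*_ (sign-∸ (ρ-mono z≤w))
                                                                     (sym (κ-mult z w z' z≤w w≤z' k)) ⟩
            sign (ρ z) * sign (ρ w) * κ z z' k          ≡⟨ reorder (sign (ρ z)) (sign (ρ w)) (κ z z' k) ⟩
            sign (ρ w) * (sign (ρ z) * κ z z' k)        ∎

      κ⋆hat-κ : κ ⋆ hat κ ≈ᴵ 1ᴵ
      κ⋆hat-κ = ≈ᴵ-trans (⋆-congˡ (hat κ) (≈ᴵ-sym (hat-involutive κ))) (hat-⋆-inverse hat-κ⋆κ)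

  module KLS (r : Carrier → Carrier → ℕ) (r-weak : IsWeakRank P r)
             (ρ : Carrier → ℕ) (ρ-mono : ∀ {z z'} → z ≤ z' → ρ z ℕ.≤ ρ z')
             (κ : Inc P) (hat-κ⋆κ : hatI P ρ κ ⋆ κ ≈ᴵ 1ᴵ)
             (f g : Inc P) (f-KLS : IsRightKLS P r κ f) (g-KLS : IsLeftKLS P r κ g) where

    open WeakRank r r-weak
    open Signed ρ ρ-mono

    f∈𝓘 : InCalI P r f
    f∈𝓘 = proj₁ (proj₁ f-KLS)

    g∈𝓘 : InCalI P r g
    g∈𝓘 = proj₁ (proj₁ g-KLS)

    f-rev : revᴵ f ≈ᴵ κ ⋆ f
    f-rev = proj₂ (proj₂ f-KLS)

    g-rev : revᴵ g ≈ᴵ g ⋆ κ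
    g-rev = proj₂ (proj₂ g-KLS)

    f-diag : ∀ z → f z z ≈ₚ 1ₚ
    f-diag = proj₁ (proj₂ f-KLS)

    g-diag : ∀ z → g z z ≈ₚ 1ₚ
    g-diag = proj₁ (proj₂ g-KLS)

    private
      1ₚ-const : DegLe 0 1ₚ
      1ₚ-const (suc _) _ = refl

    f-LowDegree : LowDegree f
    f-LowDegree = proj₂ (proj₁ f-KLS) , λ z → DegLe-cong (≈ₚ-sym (f-diag z)) 1ₚ-const

    g-LowDegree : LowDegree g
    g-LowDegree = proj₂ (proj₁ g-KLS) , λ z → DegLe-cong (≈ₚ-sym (g-diag z)) 1ₚ-const

    LowDegree-hat : ∀ {p} → LowDegree p → LowDegree (hat p)
    LowDegree-hat (p-small , p-const) =
      (λ z z' z<z' → DegLtHalf-·ₚ (sign (ρ z' ∸ ρ z)) (p-small z z' z<z')) ,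
      (λ z → DegLe-·ₚ (sign (ρ z ∸ ρ z)) (p-const z))

    hat-g⋆f : hat g ⋆ f ≈ᴵ 1ᴵ
    hat-g⋆f = revᴵ-invariant⇒1ᴵ invariant (LowDegree-⋆ (LowDegree-hat g-LowDegree) f-LowDegree) diag
      where
        invariant : revᴵ (hat g ⋆ f) ≈ᴵ hat g ⋆ f
        invariant = begin
          revᴵ (hat g ⋆ f)              ≈⟨ revᴵ-⋆ (InCalI-hat g∈𝓘) f∈𝓘 ⟩
          revᴵ (hat g) ⋆ revᴵ f         ≈⟨ ⋆-cong (≈ᴵ-sym (hat-revI r g)) f-rev ⟩
          hat (revᴵ g) ⋆ (κ ⋆ f)        ≈⟨ ⋆-congˡ (κ ⋆ f) (≈ᴵ-trans (hat-cong g-rev) (hat-⋆ g κ)) ⟩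
          (hat g ⋆ hat κ) ⋆ (κ ⋆ f)     ≈⟨ ⋆-assoc (hat g) (hat κ) (κ ⋆ f) ⟩
          hat g ⋆ (hat κ ⋆ (κ ⋆ f))     ≈⟨ ⋆-congʳ (hat g) (⋆-assoc (hat κ) κ f) ⟨
          hat g ⋆ ((hat κ ⋆ κ) ⋆ f)     ≈⟨ ⋆-congʳ (hat g) (⋆-congˡ f hat-κ⋆κ) ⟩
          hat g ⋆ (1ᴵ ⋆ f)              ≈⟨ ⋆-congʳ (hat g) (⋆-identityˡ f) ⟩
          hat g ⋆ f                     ∎
          where open ≈ᴵ-Reasoning
        diag : ∀ z → (hat g ⋆ f) z z ≈ₚ 1ₚ
        diag z k = trans (⋆-diag (hat g) f z k)
                         (trans (*ₚ-cong (≈ₚ-trans (hat-diag g z) (g-diag z)) (f-diag z) k) (*ₚ-identityˡ 1ₚ k))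

    g⋆hat-f : g ⋆ hat f ≈ᴵ 1ᴵ
    g⋆hat-f = ≈ᴵ-trans (⋆-congˡ (hat f) (≈ᴵ-sym (hat-involutive g))) (hat-⋆-inverse hat-g⋆f)

    module _ (gInv : Inc P) (gInv-inverse : IsInverse P g gInv) where

      gInv≈hat-f : gInv ≈ᴵ hat f
      gInv≈hat-f = begin
        gInv                  ≈⟨ ⋆-identityʳ gInv ⟨
        gInv ⋆ 1ᴵ             ≈⟨ ⋆-congʳ gInv g⋆hat-f ⟨
        gInv ⋆ (g ⋆ hat f)    ≈⟨ ⋆-assoc gInv g (hat f) ⟨
        (gInv ⋆ g) ⋆ hat f    ≈⟨ ⋆-congˡ (hat f) (λ z z' z≤z' → proj₂ (gInv-inverse z z' z≤z')) ⟩
        1ᴵ ⋆ hat f            ≈⟨ ⋆-identityˡ (hat f) ⟩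
        hat f                 ∎
        where open ≈ᴵ-Reasoning

      hat-f⋆g : hat f ⋆ g ≈ᴵ 1ᴵ
      hat-f⋆g = ≈ᴵ-trans (⋆-congˡ g (≈ᴵ-sym gInv≈hat-f)) (λ z z' z≤z' → proj₂ (gInv-inverse z z' z≤z'))

      f⋆hat-g : f ⋆ hat g ≈ᴵ 1ᴵ
      f⋆hat-g = ≈ᴵ-trans (⋆-congˡ (hat g) (≈ᴵ-sym (hat-involutive f))) (hat-⋆-inverse hat-f⋆g)

module _ (P : FinOrd) (P-poset : IsFinPoset P) {ρ r}
         (P-lowerEulerian : IsLowerEulerian P ρ) (r-weak : IsWeakRank P r) where

  open FinOrd P
  open IsFinPoset P-poset
  open IsLowerEulerian P-lowerEulerian using (rank-cover)
  open IsWeakRank r-weak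
  open IncidenceAlgebra P P-poset using (_<ᴾ_; diagonal-or-strict; module WeakRank)
  open WeakRank r r-weak using (r-<ˡ; r-<ʳ)

  private
    _<?ᴾ_ : ∀ z z' → Dec (z <ᴾ z')
    z <?ᴾ z' = (z ≤? z') ×-dec ¬? (z ≟ z')

    cover-below : ∀ n {z w} → r z w ℕ.≤ n → z <ᴾ w → ∃[ c ] Covers P z c × c ≤ w
    cover-below zero    r≤0 z<w = ⊥-elim (ℕ.<⇒≱ (positive _ _ z<w) r≤0)
    cover-below (suc n) {z} {w} r≤n z<w with any? (λ v → (z <?ᴾ v) ×-dec (v <?ᴾ w)) elems
    ... | yes between =
      let v , z<v , v<w = satisfied between
          c , z⋖c , c≤v = cover-below n (ℕ.≤-pred (ℕ.≤-trans (r-<ʳ (proj₁ z<v) v<w) r≤n)) z<v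
      in c , z⋖c , ≤-trans c≤v (proj₁ v<w)
    ... | no  nothing-between =
      w , (z<w , λ v z<v v<w → nothing-between (lose (elems-complete v) (z<v , v<w))) , ≤-refl w

    monotone : ∀ n {z z'} → r z z' ℕ.≤ n → z ≤ z' → ρ z ℕ.≤ ρ z'
    monotone zero    r≤0 z≤z' = diagonal-or-strict z≤z' (λ { refl → ℕ.≤-refl })
                                                      (λ z<z' → ⊥-elim (ℕ.<⇒≱ (positive _ _ z<z') r≤0))
    monotone (suc n) {z} {z'} r≤n z≤z' = diagonal-or-strict z≤z' (λ { refl → ℕ.≤-refl }) λ z<z' →
      let c , z⋖c , c≤z' = cover-below (suc n) r≤n z<z'
      in ℕ.≤-trans (ℕ.n≤1+n (ρ z))
                   (subst (ℕ._≤ ρ z') (rank-cover z c z⋖c)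
                          (monotone n (ℕ.≤-pred (ℕ.≤-trans (r-<ˡ (proj₁ z⋖c) c≤z') r≤n)) c≤z'))

  rank-monotone : ∀ {z z'} → z ≤ z' → ρ z ℕ.≤ ρ z'
  rank-monotone {z} {z'} = monotone (r z z') ℕ.≤-refl

-- Strong formal subdivisions

module StrongFormalSubdivision
  (X Y : FinOrd) (X-poset : IsFinPoset X) (Y-poset : IsFinPoset Y)
  {ρX : FinOrd.Carrier X → ℕ} {ρY : FinOrd.Carrier Y → ℕ}
  (X-lowerEulerian : IsLowerEulerian X ρX) (Y-lowerEulerian : IsLowerEulerian Y ρY)
  {σ : FinOrd.Carrier X → FinOrd.Carrier Y} (σ-subdivision : IsStrongFormalSubdivision X Y ρX ρY σ)
  {r : FinOrd.Carrier (ΓOrd X Y σ) → FinOrd.Carrier (ΓOrd X Y σ) → ℕ} (r-weak : IsWeakRank (ΓOrd X Y σ) r)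
  where

  private
    module X = FinOrd X
    module Y = FinOrd Y
    module X-poset = IsFinPoset X-poset
    module Y-poset = IsFinPoset Y-poset
  open IsStrongFormalSubdivision σ-subdivision
  open IsWeakRank r-weak

  Γ : FinOrd
  Γ = ΓOrd X Y σ

  open FinOrd Γ using (Carrier; _≤_; _≟_; elems)

  Γ-poset : IsFinPoset Γ
  Γ-poset = record
    { elems-complete = complete
    ; elems-unique   = Unique.++⁺ (Unique.map⁺ inj₁-injective X-poset.elems-unique)
                                  (Unique.map⁺ inj₂-injective Y-poset.elems-unique) disjoint
    ; ≤-refl         = reflexive
    ; ≤-antisym      = λ {z} {z'} → antisymmetric {z} {z'}
    ; ≤-trans        = λ {z} {z'} {z''} → transitive {z} {z'} {z''}
    }
    where
      complete : ∀ z → z ∈ elems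
      complete (inj₁ x) = ∈-++⁺ˡ (∈-map⁺ inj₁ (X-poset.elems-complete x))
      complete (inj₂ y) = ∈-++⁺ʳ (map inj₁ X.elems) (∈-map⁺ inj₂ (Y-poset.elems-complete y))
      disjoint : ∀ {z} → ¬ (z ∈ map inj₁ X.elems × z ∈ map inj₂ Y.elems)
      disjoint (z∈X , z∈Y) with ∈-map⁻ inj₁ z∈X | ∈-map⁻ inj₂ z∈Y
      ... | _ , _ , refl | _ , _ , ()
      reflexive : ∀ z → z ≤ z
      reflexive (inj₁ x) = X-poset.≤-refl x
      reflexive (inj₂ y) = Y-poset.≤-refl y
      antisymmetric : ∀ {z z'} → z ≤ z' → z' ≤ z → z ≡ z'
      antisymmetric {inj₁ _} {inj₁ _} x≤x' x'≤x = cong inj₁ (X-poset.≤-antisym x≤x' x'≤x)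
      antisymmetric {inj₂ _} {inj₂ _} y≤y' y'≤y = cong inj₂ (Y-poset.≤-antisym y≤y' y'≤y)
      transitive : ∀ {z z' z''} → z ≤ z' → z' ≤ z'' → z ≤ z''
      transitive {inj₁ _} {inj₁ _} {inj₁ _} = X-poset.≤-trans
      transitive {inj₁ _} {inj₁ _} {inj₂ _} x≤x' σx'≤y = Y-poset.≤-trans (order-preserving x≤x') σx'≤y
      transitive {inj₁ _} {inj₂ _} {inj₂ _} = Y-poset.≤-trans
      transitive {inj₂ _} {inj₂ _} {inj₂ _} = Y-poset.≤-trans

  Σℤ-Γ : ∀ (b : Carrier → Bool) (F : Carrier → ℤ) →
         Σℤ elems b F ≡ Σℤ X.elems (b ∘ inj₁) (F ∘ inj₁) + Σℤ Y.elems (b ∘ inj₂) (F ∘ inj₂)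
  Σℤ-Γ b F = trans (Σℤ-++ (map inj₁ X.elems) (map inj₂ Y.elems) b F)
                   (cong₂ _+_ (Σℤ-map inj₁ X.elems b F) (Σℤ-map inj₂ Y.elems b F))

  ρ : Carrier → ℕ
  ρ = ρΓ X Y ρX ρY

  private
    X-weakRank : IsWeakRank X (λ x x' → r (inj₁ x) (inj₁ x'))
    X-weakRank = record
      { positive = λ x x' (x≤x' , x≢x') → positive (inj₁ x) (inj₁ x') (x≤x' , x≢x' ∘ inj₁-injective)
      ; additive = λ x w x' → additive (inj₁ x) (inj₁ w) (inj₁ x')
      }
    Y-weakRank : IsWeakRank Y (λ y y' → r (inj₂ y) (inj₂ y'))
    Y-weakRank = record
      { positive = λ y y' (y≤y' , y≢y') → positive (inj₂ y) (inj₂ y') (y≤y' , y≢y' ∘ inj₂-injective)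
      ; additive = λ y w y' → additive (inj₂ y) (inj₂ w) (inj₂ y')
      }

  ρX-monotone : ∀ {x x'} → x X.≤ x' → ρX x ℕ.≤ ρX x'
  ρX-monotone = rank-monotone X X-poset X-lowerEulerian X-weakRank

  ρY-monotone : ∀ {y y'} → y Y.≤ y' → ρY y ℕ.≤ ρY y'
  ρY-monotone = rank-monotone Y Y-poset Y-lowerEulerian Y-weakRank

  ρ-monotone : ∀ {z z'} → z ≤ z' → ρ z ℕ.≤ ρ z'
  ρ-monotone {inj₁ _} {inj₁ _} x≤x'  = ρX-monotone x≤x'
  ρ-monotone {inj₁ x} {inj₂ _} σx≤y  = ℕ.m≤n⇒m≤1+n (ℕ.≤-trans (rank-le x) (ρY-monotone σx≤y))
  ρ-monotone {inj₂ _} {inj₂ _} y≤y'  = ℕ.s≤s (ρY-monotone y≤y')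

  between-in-X : X.Carrier → Y.Carrier → X.Carrier → Bool
  between-in-X x y x' = does (x X.≤? x') ∧ does (σ x' Y.≤? y)

  between-in-Y : X.Carrier → Y.Carrier → Y.Carrier → Bool
  between-in-Y x y y' = does (σ x Y.≤? y') ∧ does (y' Y.≤? y)

  fibre-above : X.Carrier → Y.Carrier → X.Carrier → Bool
  fibre-above x y x' = does (x X.≤? x') ∧ does (σ x' Y.≟ y)

  ∈-between-in-X : ∀ {x y x'} → T (between-in-X x y x') ⇔ (x X.≤ x' × σ x' Y.≤ y)
  ∈-between-in-X {x} {y} {x'} = T-does-∧ (x X.≤? x') (σ x' Y.≤? y)

  ∈-between-in-Y : ∀ {x y y'} → T (between-in-Y x y y') ⇔ (σ x Y.≤ y' × y' Y.≤ y)
  ∈-between-in-Y {x} {y} {y'} = T-does-∧ (σ x Y.≤? y') (y' Y.≤? y)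

  ∈-fibre-above : ∀ {x y x'} → T (fibre-above x y x') ⇔ (x X.≤ x' × σ x' ≡ y)
  ∈-fibre-above {x} {y} {x'} = T-does-∧ (x X.≤? x') (σ x' Y.≟ y)

  Σ-by-fibres : ∀ x y (F : X.Carrier → ℤ) →
    Σℤ X.elems (between-in-X x y) F ≡ Σℤ Y.elems (between-in-Y x y) (λ y' → Σℤ X.elems (fibre-above x y') F)
  Σ-by-fibres x y F = trans (Σℤ-cong X.elems _ (λ x' _ _ → sym (Σ-at-image x' (F x'))))
                            (Σℤ-swap X.elems Y.elems (λ x' _ → F x') same-pairs)
    where
      Σ-at-image : ∀ x' c → Σℤ Y.elems (λ y' → does (σ x' Y.≟ y')) (λ _ → c) ≡ c
      Σ-at-image x' c = Σℤ-single _ (λ _ → c) Y-poset.elems-unique (Y-poset.elems-complete (σ x'))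
        (from (T-does (σ x' Y.≟ σ x')) refl)
        (λ y' σx'≡y' y'≢σx' → ⊥-elim (y'≢σx' (sym (to (T-does (σ x' Y.≟ y')) σx'≡y'))))
      same-pairs : ∀ x' y' → T (between-in-X x y x' ∧ does (σ x' Y.≟ y')) ⇔
                             T (between-in-Y x y y' ∧ fibre-above x y' x')
      same-pairs x' y' = mk⇔ (from rhs ∘ forward ∘ to lhs) (from lhs ∘ backward ∘ to rhs)
        where
          lhs = T-∧⇔ ∈-between-in-X (T-does (σ x' Y.≟ y'))
          rhs = T-∧⇔ ∈-between-in-Y ∈-fibre-above
          forward : (x X.≤ x' × σ x' Y.≤ y) × σ x' ≡ y' →
                    (σ x Y.≤ y' × y' Y.≤ y) × (x X.≤ x' × σ x' ≡ y')
          forward ((x≤x' , σx'≤y) , refl) = (order-preserving x≤x' , σx'≤y) , (x≤x' , refl)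
          backward : (σ x Y.≤ y' × y' Y.≤ y) × (x X.≤ x' × σ x' ≡ y') →
                     (x X.≤ x' × σ x' Y.≤ y) × σ x' ≡ y'
          backward ((_ , y'≤y) , (x≤x' , refl)) = (x≤x' , y'≤y) , refl

  Σ-fibre-sign : ∀ x y → σ x Y.≤ y → Σℤ X.elems (fibre-above x y) (sign ∘ ρX) ≡ sign (ρY y)
  Σ-fibre-sign x y σx≤y = begin
    S                                     ≡⟨ ℤ.*-identityʳ S ⟨
    S * 1ℤ                                ≡⟨ cong (S *_) (sign-*-sign (ρY y)) ⟨
    S * (sign (ρY y) * sign (ρY y))       ≡⟨ ℤ.*-assoc S _ _ ⟨
    S * sign (ρY y) * sign (ρY y)         ≡⟨ cong (_* sign (ρY y)) S*sign≡1 ⟩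
    1ℤ * sign (ρY y)                      ≡⟨ ℤ.*-identityˡ _ ⟩
    sign (ρY y)                           ∎
    where
      open ≡-Reasoning
      S = Σℤ X.elems (fibre-above x y) (sign ∘ ρX)
      S*sign≡1 : S * sign (ρY y) ≡ 1ℤ
      S*sign≡1 = trans (Σℤ-*ʳ X.elems (fibre-above x y) (sign (ρY y)) (sign ∘ ρX))
                       (trans (Σℤ-cong X.elems (fibre-above x y) λ x' _ x'∈ →
                                 sym (sign-∸ (rank-≤ x' (to ∈-fibre-above x'∈))))
                              (alternating-sum x y σx≤y))
        where
          rank-≤ : ∀ x' → x X.≤ x' × σ x' ≡ y → ρX x' ℕ.≤ ρY y
          rank-≤ x' (_ , refl) = rank-le x'

  Σ-restrict-to-fibre : ∀ x y (F : X.Carrier → ℤ) →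
    Σℤ X.elems (between-in-X x y) (λ x' → if does (σ x' Y.≟ y) then F x' else 0ℤ) ≡ Σℤ X.elems (fibre-above x y) F
  Σ-restrict-to-fibre x y F = trans (Σℤ-if X.elems _ _ F) (Σℤ-filter-cong X.elems F (λ x' → T-injective (same x')))
    where
      same : ∀ x' → T (between-in-X x y x' ∧ does (σ x' Y.≟ y)) ⇔ T (fibre-above x y x')
      same x' = mk⇔ (from ∈-fibre-above ∘ forget-≤ ∘ to between) (from between ∘ add-≤ ∘ to ∈-fibre-above)
        where
          between = T-∧⇔ ∈-between-in-X (T-does (σ x' Y.≟ y))
          forget-≤ : (x X.≤ x' × σ x' Y.≤ y) × σ x' ≡ y → x X.≤ x' × σ x' ≡ y
          forget-≤ ((x≤x' , _) , σx'≡y) = x≤x' , σx'≡y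
          add-≤ : x X.≤ x' × σ x' ≡ y → (x X.≤ x' × σ x' Y.≤ y) × σ x' ≡ y
          add-≤ (x≤x' , refl) = (x≤x' , Y-poset.≤-refl (σ x')) , refl

  open IncidenceAlgebra Γ Γ-poset public

  Γ-eulerian : IsEulerian ρ
  Γ-eulerian (inj₁ x) (inj₁ x') (x≤x' , x≢x') = begin
    Σℤ elems (inInterval Γ (inj₁ x) (inj₁ x')) (sign ∘ ρ)
      ≡⟨ Σℤ-Γ _ _ ⟩
    Σℤ X.elems _ (sign ∘ ρX) + Σℤ Y.elems _ (sign ∘ ρ ∘ inj₂)
      ≡⟨ cong₂ _+_ (IsLowerEulerian.eulerian X-lowerEulerian x x' (x≤x' , x≢x' ∘ cong inj₁))
                   (Σℤ-zero Y.elems _ _ (λ _ _ → ⊥-elim ∘ proj₂ ∘ to T-∧)) ⟩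
    0ℤ ∎
    where open ≡-Reasoning
  Γ-eulerian (inj₁ x) (inj₂ y) (σx≤y , _) = begin
    Σℤ elems (inInterval Γ (inj₁ x) (inj₂ y)) (sign ∘ ρ)
      ≡⟨ Σℤ-Γ _ _ ⟩
    Σℤ X.elems (between-in-X x y) (sign ∘ ρX) + Σℤ Y.elems (between-in-Y x y) (λ y' → - sign (ρY y'))
      ≡⟨ cong₂ _+_ X-part (Σℤ-neg Y.elems (between-in-Y x y) (sign ∘ ρY)) ⟩
    Σℤ Y.elems (between-in-Y x y) (sign ∘ ρY) + - Σℤ Y.elems (between-in-Y x y) (sign ∘ ρY)
      ≡⟨ ℤ.+-inverseʳ (Σℤ Y.elems (between-in-Y x y) (sign ∘ ρY)) ⟩
    0ℤ ∎
    where
      open ≡-Reasoning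
      X-part : Σℤ X.elems (between-in-X x y) (sign ∘ ρX) ≡ Σℤ Y.elems (between-in-Y x y) (sign ∘ ρY)
      X-part = trans (Σ-by-fibres x y (sign ∘ ρX))
                     (Σℤ-cong Y.elems _ (λ y' _ y'∈ → Σ-fibre-sign x y' (proj₁ (to ∈-between-in-Y y'∈))))
  Γ-eulerian (inj₂ y) (inj₂ y') (y≤y' , y≢y') = begin
    Σℤ elems (inInterval Γ (inj₂ y) (inj₂ y')) (sign ∘ ρ)
      ≡⟨ Σℤ-Γ _ _ ⟩
    Σℤ X.elems _ _ + Σℤ Y.elems interval (λ y'' → - sign (ρY y''))
      ≡⟨ cong₂ _+_ (Σℤ-zero X.elems _ _ (λ _ _ ())) (Σℤ-neg Y.elems interval (sign ∘ ρY)) ⟩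
    0ℤ + - Σℤ Y.elems interval (sign ∘ ρY)
      ≡⟨ cong (λ s → 0ℤ + - s) (IsLowerEulerian.eulerian Y-lowerEulerian y y' (y≤y' , y≢y' ∘ cong inj₂)) ⟩
    0ℤ ∎
    where
      open ≡-Reasoning
      interval = λ y'' → does (y Y.≤? y'') ∧ does (y'' Y.≤? y')

  open WeakRank r r-weak public
  open Signed ρ (λ {z} {z'} → ρ-monotone {z} {z'}) public

  restrictXY : Inc Γ → Inc Γ
  restrictXY p (inj₁ x) (inj₂ y) = p (inj₁ x) (inj₂ y)
  restrictXY p (inj₁ _) (inj₁ _) = 0ₚ
  restrictXY p (inj₂ _) _        = 0ₚ

  restrictXY-+ᴵ : ∀ p q → restrictXY (p +ᴵ q) ≈ᴵ restrictXY p +ᴵ restrictXY q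
  restrictXY-+ᴵ p q (inj₁ _) (inj₂ _) _ _ = refl
  restrictXY-+ᴵ p q (inj₁ _) (inj₁ _) _ _ = refl
  restrictXY-+ᴵ p q (inj₂ _) (inj₂ _) _ _ = refl

  restrictXY--ᴵ : ∀ p → restrictXY (-ᴵ p) ≈ᴵ -ᴵ restrictXY p
  restrictXY--ᴵ p (inj₁ _) (inj₂ _) _ _ = refl
  restrictXY--ᴵ p (inj₁ _) (inj₁ _) _ _ = refl
  restrictXY--ᴵ p (inj₂ _) (inj₂ _) _ _ = refl

  SupportedOnXY : Inc Γ → Set
  SupportedOnXY p = (∀ x x' → x X.≤ x' → p (inj₁ x) (inj₁ x') ≈ₚ 0ₚ) ×
                    (∀ y y' → y Y.≤ y' → p (inj₂ y) (inj₂ y') ≈ₚ 0ₚ)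

  OnXY : (Carrier → Carrier → Set) → Set
  OnXY R = ∀ x y → σ x Y.≤ y → R (inj₁ x) (inj₂ y)

  supported⇒≈restrictXY : ∀ {p} → SupportedOnXY p → p ≈ᴵ restrictXY p
  supported⇒≈restrictXY (onX , _  ) (inj₁ x) (inj₁ x') x≤x' = onX x x' x≤x'
  supported⇒≈restrictXY _           (inj₁ _) (inj₂ _)  _    = ≈ₚ-refl
  supported⇒≈restrictXY (_   , onY) (inj₂ y) (inj₂ y') y≤y' = onY y y' y≤y'

  SupportedOnXY-cong : ∀ {p q} → p ≈ᴵ q → SupportedOnXY p → SupportedOnXY q
  SupportedOnXY-cong p≈q (onX , onY) =
    (λ x x' x≤x' → ≈ₚ-trans (≈ₚ-sym (p≈q (inj₁ x) (inj₁ x') x≤x')) (onX x x' x≤x')) ,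
    (λ y y' y≤y' → ≈ₚ-trans (≈ₚ-sym (p≈q (inj₂ y) (inj₂ y') y≤y')) (onY y y' y≤y'))

  SupportedOnXY-⋆ˡ : ∀ {p} q → SupportedOnXY p → SupportedOnXY (p ⋆ q)
  SupportedOnXY-⋆ˡ {p} q (onX , onY) =
    (λ x x' _ → ⋆-vanishes p q (onXX x x')) , (λ y y' _ → ⋆-vanishes p q (onYY y y'))
    where
      onXX : ∀ x x' w → inj₁ x ≤ w → w ≤ inj₁ x' → p (inj₁ x) w *ₚ q w (inj₁ x') ≈ₚ 0ₚ
      onXX x x' (inj₁ c) x≤c _ = *ₚ-vanishesˡ (q (inj₁ c) (inj₁ x')) (onX x c x≤c)
      onYY : ∀ y y' w → inj₂ y ≤ w → w ≤ inj₂ y' → p (inj₂ y) w *ₚ q w (inj₂ y') ≈ₚ 0ₚ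
      onYY y y' (inj₂ c) y≤c _ = *ₚ-vanishesˡ (q (inj₂ c) (inj₂ y')) (onY y c y≤c)

  SupportedOnXY-⋆ʳ : ∀ p {q} → SupportedOnXY q → SupportedOnXY (p ⋆ q)
  SupportedOnXY-⋆ʳ p {q} (onX , onY) =
    (λ x x' _ → ⋆-vanishes p q (onXX x x')) , (λ y y' _ → ⋆-vanishes p q (onYY y y'))
    where
      onXX : ∀ x x' w → inj₁ x ≤ w → w ≤ inj₁ x' → p (inj₁ x) w *ₚ q w (inj₁ x') ≈ₚ 0ₚ
      onXX x x' (inj₁ c) _ c≤x' = *ₚ-vanishesʳ (p (inj₁ x) (inj₁ c)) (onX c x' c≤x')
      onYY : ∀ y y' w → inj₂ y ≤ w → w ≤ inj₂ y' → p (inj₂ y) w *ₚ q w (inj₂ y') ≈ₚ 0ₚ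
      onYY y y' (inj₂ c) _ c≤y' = *ₚ-vanishesʳ (p (inj₂ y) (inj₂ c)) (onY c y' c≤y')

  SupportedOnXY-rev : ∀ {p} → SupportedOnXY p → SupportedOnXY (revᴵ p)
  SupportedOnXY-rev (onX , onY) =
    (λ x x' x≤x' → ≈ₚ-trans (rev-cong _ (onX x x' x≤x')) (rev-0ₚ _)) ,
    (λ y y' y≤y' → ≈ₚ-trans (rev-cong _ (onY y y' y≤y')) (rev-0ₚ _))

  SupportedOnXY-hat : ∀ {p} → SupportedOnXY p → SupportedOnXY (hat p)
  SupportedOnXY-hat (onX , onY) =
    (λ x x' x≤x' → scaled-0 (sign (ρX x' ∸ ρX x)) (onX x x' x≤x')) ,
    (λ y y' y≤y' → scaled-0 (sign (ρY y' ∸ ρY y)) (onY y y' y≤y'))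
    where
      scaled-0 : ∀ c {p} → p ≈ₚ 0ₚ → c ·ₚ p ≈ₚ 0ₚ
      scaled-0 c p≈0 k = trans (cong (c *_) (p≈0 k)) (ℤ.*-zeroʳ c)

  ⋆-splitXY : ∀ p q x y → (p ⋆ q) (inj₁ x) (inj₂ y) ≈ₚ
                          (p ⋆ restrictXY q) (inj₁ x) (inj₂ y) +ₚ (restrictXY p ⋆ q) (inj₁ x) (inj₂ y)
  ⋆-splitXY p q x y k =
    trans (Σℤ-cong elems (inInterval Γ (inj₁ x) (inj₂ y)) (λ w _ _ → split w))
          (Σℤ-+ elems (inInterval Γ (inj₁ x) (inj₂ y)) (λ w → (p (inj₁ x) w *ₚ restrictXY q w (inj₂ y)) k)
                                                      (λ w → (restrictXY p (inj₁ x) w *ₚ q w (inj₂ y)) k))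
    where
      split : ∀ w → (p (inj₁ x) w *ₚ q w (inj₂ y)) k ≡
                    (p (inj₁ x) w *ₚ restrictXY q w (inj₂ y)) k + (restrictXY p (inj₁ x) w *ₚ q w (inj₂ y)) k
      split (inj₁ c) = sym (trans (cong ((p (inj₁ x) (inj₁ c) *ₚ q (inj₁ c) (inj₂ y)) k +_)
                                        (*ₚ-zeroˡ (q (inj₁ c) (inj₂ y)) k))
                                  (ℤ.+-identityʳ _))
      split (inj₂ c) = sym (trans (cong (_+ (p (inj₁ x) (inj₂ c) *ₚ q (inj₂ c) (inj₂ y)) k)
                                        (*ₚ-zeroʳ (p (inj₁ x) (inj₂ c)) k))
                                  (ℤ.+-identityˡ _))

  neg-⋆-hat-expansion : ∀ p Q → SupportedOnXY Q → ∀ x y →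
    (-ᴵ (p ⋆ hat Q)) (inj₁ x) (inj₂ y) ≈ₚ
    Σₚ X.elems (between-in-X x y) (λ x' → sign (ρY y ∸ ρX x') ·ₚ (p (inj₁ x) (inj₁ x') *ₚ Q (inj₁ x') (inj₂ y)))
  neg-⋆-hat-expansion p Q Q-supported x y k = begin
    - Σℤ elems (inInterval Γ (inj₁ x) (inj₂ y)) (λ w → (p (inj₁ x) w *ₚ hat Q w (inj₂ y)) k)
      ≡⟨ cong -_ (Σℤ-Γ _ _) ⟩
    - (Σℤ X.elems (between-in-X x y) X-term + Σℤ Y.elems (between-in-Y x y) Y-term)
      ≡⟨ cong (λ s → - (Σℤ X.elems (between-in-X x y) X-term + s))
              (Σℤ-zero Y.elems (between-in-Y x y) Y-term (λ y' _ y'∈ → Y-term≡0 y' (proj₂ (to ∈-between-in-Y y'∈)))) ⟩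
    - (Σℤ X.elems (between-in-X x y) X-term + 0ℤ)
      ≡⟨ cong -_ (ℤ.+-identityʳ _) ⟩
    - Σℤ X.elems (between-in-X x y) X-term
      ≡⟨ Σℤ-neg X.elems (between-in-X x y) X-term ⟨
    Σℤ X.elems (between-in-X x y) (λ x' → - X-term x')
      ≡⟨ Σℤ-cong X.elems (between-in-X x y) (λ x' _ x'∈ → neg-X-term x' (proj₂ (to ∈-between-in-X x'∈))) ⟩
    Σℤ X.elems (between-in-X x y) (λ x' → sign (ρY y ∸ ρX x') * (p (inj₁ x) (inj₁ x') *ₚ Q (inj₁ x') (inj₂ y)) k) ∎
    where
      open ≡-Reasoning
      X-term : X.Carrier → ℤ
      X-term x' = (p (inj₁ x) (inj₁ x') *ₚ hat Q (inj₁ x') (inj₂ y)) k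
      Y-term : Y.Carrier → ℤ
      Y-term y' = (p (inj₁ x) (inj₂ y') *ₚ hat Q (inj₂ y') (inj₂ y)) k
      Y-term≡0 : ∀ y' → y' Y.≤ y → Y-term y' ≡ 0ℤ
      Y-term≡0 y' y'≤y = *ₚ-vanishesʳ (p (inj₁ x) (inj₂ y')) (proj₂ (SupportedOnXY-hat {Q} Q-supported) y' y y'≤y) k
      neg-X-term : ∀ x' → σ x' Y.≤ y → - X-term x' ≡ sign (ρY y ∸ ρX x') * (p (inj₁ x) (inj₁ x') *ₚ Q (inj₁ x') (inj₂ y)) k
      neg-X-term x' σx'≤y = begin
        - (p (inj₁ x) (inj₁ x') *ₚ (sign (suc (ρY y) ∸ ρX x') ·ₚ Q (inj₁ x') (inj₂ y))) k
          ≡⟨ cong -_ (*ₚ-·ₚ (sign (suc (ρY y) ∸ ρX x')) (p (inj₁ x) (inj₁ x')) (Q (inj₁ x') (inj₂ y)) k) ⟩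
        - (sign (suc (ρY y) ∸ ρX x') * pQ)
          ≡⟨ cong (λ n → - (sign n * pQ)) (ℕ.+-∸-assoc 1 (ℕ.≤-trans (rank-le x') (ρY-monotone σx'≤y))) ⟩
        - (- sign (ρY y ∸ ρX x') * pQ)
          ≡⟨ neg-neg-* (sign (ρY y ∸ ρX x')) pQ ⟩
        sign (ρY y ∸ ρX x') * pQ ∎
        where
          pQ = (p (inj₁ x) (inj₁ x') *ₚ Q (inj₁ x') (inj₂ y)) k
          neg-neg-* : ∀ a b → - (- a * b) ≡ a * b
          neg-neg-* = solve-∀

  rev-⋆-expansion : ∀ Q → SupportedOnXY Q → ∀ p x y →
    (revᴵ Q ⋆ p) (inj₁ x) (inj₂ y) ≈ₚ
    Σₚ Y.elems (between-in-Y x y) (λ y' → rev (r (inj₁ x) (inj₂ y')) (Q (inj₁ x) (inj₂ y')) *ₚ p (inj₂ y') (inj₂ y))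
  rev-⋆-expansion Q Q-supported p x y k = begin
    Σℤ elems (inInterval Γ (inj₁ x) (inj₂ y)) (λ w → (revᴵ Q (inj₁ x) w *ₚ p w (inj₂ y)) k)
      ≡⟨ Σℤ-Γ _ _ ⟩
    Σℤ X.elems (between-in-X x y) X-term + Y-part
      ≡⟨ cong (_+ Y-part) (Σℤ-zero X.elems (between-in-X x y) X-term λ x' _ x'∈ →
                              *ₚ-vanishesˡ (p (inj₁ x') (inj₂ y)) (revQ-onX x' (proj₁ (to ∈-between-in-X x'∈))) k) ⟩
    0ℤ + Y-part
      ≡⟨ ℤ.+-identityˡ Y-part ⟩
    Y-part ∎
    where
      open ≡-Reasoning
      X-term : X.Carrier → ℤ
      X-term x' = (revᴵ Q (inj₁ x) (inj₁ x') *ₚ p (inj₁ x') (inj₂ y)) k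
      Y-part = Σℤ Y.elems (between-in-Y x y)
                  (λ y' → (rev (r (inj₁ x) (inj₂ y')) (Q (inj₁ x) (inj₂ y')) *ₚ p (inj₂ y') (inj₂ y)) k)
      revQ-onX : ∀ x' → x X.≤ x' → revᴵ Q (inj₁ x) (inj₁ x') ≈ₚ 0ₚ
      revQ-onX = proj₁ (SupportedOnXY-rev {Q} Q-supported) x

  module Kernel (κ : Inc Γ) (κ∈𝓘 : InCalI Γ r κ) (κ-diag : InU Γ r κ)
                (κ-mult : Multiplicative Γ κ) (κ-alt : RankAlternating Γ r ρ κ) where

    open MultiplicativeKernel κ κ-diag κ-mult Γ-eulerian public

    κ° : Inc Γ
    κ° = restrict° X Y σ κ

    κ°-supported : SupportedOnXY κ°
    κ°-supported = (λ _ _ _ _ → refl) , (λ _ _ _ _ → refl)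

    hat-κ°-supported : SupportedOnXY (hat κ°)
    hat-κ°-supported = SupportedOnXY-hat {κ°} κ°-supported

    κ°∈𝓘 : InCalI Γ r κ°
    κ°∈𝓘 (inj₁ x) (inj₂ y) σx≤y with does (σ x Y.≟ y)
    ... | true  = κ∈𝓘 (inj₁ x) (inj₂ y) σx≤y
    ... | false = λ _ _ → refl
    κ°∈𝓘 (inj₁ _) (inj₁ _) _ _ _ = refl
    κ°∈𝓘 (inj₂ _) (inj₂ _) _ _ _ = refl

    κ°-rev : revᴵ κ° ≈ᴵ hat κ°
    κ°-rev (inj₁ x) (inj₂ y) σx≤y with does (σ x Y.≟ y)
    ... | true  = κ-alt (inj₁ x) (inj₂ y) σx≤y
    ... | false = λ k → trans (rev-0ₚ _ k) (sym (ℤ.*-zeroʳ (sign (suc (ρY y) ∸ ρX x))))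
    κ°-rev (inj₁ x) (inj₁ x') _ k = trans (rev-0ₚ _ k) (sym (ℤ.*-zeroʳ (sign (ρX x' ∸ ρX x))))
    κ°-rev (inj₂ y) (inj₂ y') _ k = trans (rev-0ₚ _ k) (sym (ℤ.*-zeroʳ (sign (ρY y' ∸ ρY y))))

    κ°⋆κ : κ° ⋆ κ ≈ᴵ restrictXY κ
    κ°⋆κ (inj₁ x) (inj₂ y) σx≤y k = begin
      (κ° ⋆ κ) (inj₁ x) (inj₂ y) k
        ≡⟨ ⋆-single-term κ° κ {inj₁ x} {inj₂ y} (inj₂ (σ x)) (Y-poset.≤-refl (σ x)) σx≤y only-σx k ⟩
      (κ° (inj₁ x) (inj₂ (σ x)) *ₚ κ (inj₂ (σ x)) (inj₂ y)) k
        ≡⟨ cong (λ u → (u *ₚ κ (inj₂ (σ x)) (inj₂ y)) k) κ°-at-σx ⟩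
      (κ (inj₁ x) (inj₂ (σ x)) *ₚ κ (inj₂ (σ x)) (inj₂ y)) k
        ≡⟨ κ-mult (inj₁ x) (inj₂ (σ x)) (inj₂ y) (Y-poset.≤-refl (σ x)) σx≤y k ⟨
      κ (inj₁ x) (inj₂ y) k ∎
      where
        open ≡-Reasoning
        κ°-at-σx : κ° (inj₁ x) (inj₂ (σ x)) ≡ κ (inj₁ x) (inj₂ (σ x))
        κ°-at-σx rewrite dec-true (σ x Y.≟ σ x) refl = refl
        only-σx : ∀ w → inj₁ x ≤ w → w ≤ inj₂ y → w ≢ inj₂ (σ x) → κ° (inj₁ x) w *ₚ κ w (inj₂ y) ≈ₚ 0ₚ
        only-σx (inj₁ c) _ _ _ = *ₚ-zeroˡ (κ (inj₁ c) (inj₂ y))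
        only-σx (inj₂ c) _ _ c≢σx rewrite dec-false (σ x Y.≟ c) (c≢σx ∘ cong inj₂ ∘ sym) = *ₚ-zeroˡ (κ (inj₂ c) (inj₂ y))
    κ°⋆κ (inj₁ x) (inj₁ x') x≤x' = proj₁ (SupportedOnXY-⋆ˡ {κ°} κ κ°-supported) x x' x≤x'
    κ°⋆κ (inj₂ y) (inj₂ y') y≤y' = proj₂ (SupportedOnXY-⋆ˡ {κ°} κ κ°-supported) y y' y≤y'

    private
      κ⋆hat-κ°-term : ∀ {x x'} y → x X.≤ x' → ∀ k →
                      (κ (inj₁ x) (inj₁ x') *ₚ hat κ° (inj₁ x') (inj₂ y)) k ≡
                      (if does (σ x' Y.≟ y) then - (sign (ρY y ∸ ρX x') * κ (inj₁ x) (inj₂ y) k) else 0ℤ)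
      κ⋆hat-κ°-term {x} {x'} y x≤x' k with σ x' Y.≟ y
      ... | yes refl = begin
        (κ (inj₁ x) (inj₁ x') *ₚ (s ·ₚ κ (inj₁ x') (inj₂ (σ x')))) k
          ≡⟨ *ₚ-·ₚ s (κ (inj₁ x) (inj₁ x')) (κ (inj₁ x') (inj₂ (σ x'))) k ⟩
        s * (κ (inj₁ x) (inj₁ x') *ₚ κ (inj₁ x') (inj₂ (σ x'))) k
          ≡⟨ cong₂ _*_ (cong sign (ℕ.+-∸-assoc 1 (rank-le x')))
                       (sym (κ-mult (inj₁ x) (inj₁ x') (inj₂ (σ x')) x≤x' (Y-poset.≤-refl (σ x')) k)) ⟩
        - sign (ρY (σ x') ∸ ρX x') * κ (inj₁ x) (inj₂ (σ x')) k
          ≡⟨ ℤ.neg-distribˡ-* (sign (ρY (σ x') ∸ ρX x')) _ ⟨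
        - (sign (ρY (σ x') ∸ ρX x') * κ (inj₁ x) (inj₂ (σ x')) k) ∎
        where
          open ≡-Reasoning
          s = sign (suc (ρY (σ x')) ∸ ρX x')
      ... | no  _ = trans (*ₚ-·ₚ s (κ (inj₁ x) (inj₁ x')) 0ₚ k)
                          (trans (cong (s *_) (*ₚ-zeroʳ (κ (inj₁ x) (inj₁ x')) k)) (ℤ.*-zeroʳ s))
        where s = sign (suc (ρY y) ∸ ρX x')

    κ⋆hat-κ° : κ ⋆ hat κ° ≈ᴵ -ᴵ restrictXY κ
    κ⋆hat-κ° (inj₁ x) (inj₂ y) σx≤y k = begin
      (κ ⋆ hat κ°) (inj₁ x) (inj₂ y) k
        ≡⟨ Σℤ-Γ _ _ ⟩
      Σℤ X.elems (between-in-X x y) (λ x' → (κ (inj₁ x) (inj₁ x') *ₚ hat κ° (inj₁ x') (inj₂ y)) k) +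
      Σℤ Y.elems _ (λ y' → (κ (inj₁ x) (inj₂ y') *ₚ hat κ° (inj₂ y') (inj₂ y)) k)
        ≡⟨ cong₂ _+_ (Σℤ-cong X.elems _ (λ x' _ x'∈ → κ⋆hat-κ°-term y (proj₁ (to ∈-between-in-X x'∈)) k))
                     (Σℤ-zero Y.elems _ _ λ y' _ y'∈ →
                        *ₚ-vanishesʳ (κ (inj₁ x) (inj₂ y')) (proj₂ hat-κ°-supported y' y (proj₂ (to ∈-between-in-Y y'∈))) k) ⟩
      Σℤ X.elems (between-in-X x y) (λ x' → if does (σ x' Y.≟ y) then - (sign (ρY y ∸ ρX x') * K) else 0ℤ) + 0ℤ
        ≡⟨ trans (ℤ.+-identityʳ _) (Σ-restrict-to-fibre x y (λ x' → - (sign (ρY y ∸ ρX x') * K))) ⟩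
      Σℤ X.elems (fibre-above x y) (λ x' → - (sign (ρY y ∸ ρX x') * K))
        ≡⟨ Σℤ-neg X.elems (fibre-above x y) (λ x' → sign (ρY y ∸ ρX x') * K) ⟩
      - Σℤ X.elems (fibre-above x y) (λ x' → sign (ρY y ∸ ρX x') * K)
        ≡⟨ cong -_ (Σℤ-*ʳ X.elems (fibre-above x y) K (λ x' → sign (ρY y ∸ ρX x'))) ⟨
      - (Σℤ X.elems (fibre-above x y) (λ x' → sign (ρY y ∸ ρX x')) * K)
        ≡⟨ cong (λ s → - (s * K)) (alternating-sum x y σx≤y) ⟩
      - (1ℤ * K)
        ≡⟨ cong -_ (ℤ.*-identityˡ K) ⟩
      - K ∎
      where
        open ≡-Reasoning
        K = κ (inj₁ x) (inj₂ y) k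
    κ⋆hat-κ° (inj₁ x) (inj₁ x') x≤x' = proj₁ (SupportedOnXY-⋆ʳ κ {hat κ°} hat-κ°-supported) x x' x≤x'
    κ⋆hat-κ° (inj₂ y) (inj₂ y') y≤y' = proj₂ (SupportedOnXY-⋆ʳ κ {hat κ°} hat-κ°-supported) y y' y≤y'

    -- The other terms of the right-hand side involve E on shorter intervals, so by induction
    -- on the rank E x y is rev-invariant; having degree < r/2, it vanishes.
    leftKLS-onXY⇒0 : ∀ E → OnXY (λ z z' → revᴵ E z z' ≈ₚ (restrictXY E ⋆ κ) z z') →
                     OnXY (λ z z' → DegLtHalf (r z z') (E z z')) → OnXY (λ z z' → E z z' ≈ₚ 0ₚ)
    leftKLS-onXY⇒0 E E-rev E-small x y σx≤y = by-rank (suc (r (inj₁ x) (inj₂ y))) x y σx≤y ℕ.≤-refl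
      where
        by-rank : ∀ n x y → σ x Y.≤ y → r (inj₁ x) (inj₂ y) < n → E (inj₁ x) (inj₂ y) ≈ₚ 0ₚ
        by-rank (suc n) x y σx≤y r<n = rev-invariant⇒0 (r (inj₁ x) (inj₂ y)) invariant (E-small x y σx≤y)
          where
            shorter : ∀ w → inj₁ x ≤ w → w ≤ inj₂ y → w ≢ inj₂ y → restrictXY E (inj₁ x) w *ₚ κ w (inj₂ y) ≈ₚ 0ₚ
            shorter (inj₁ c) _    _   _   = *ₚ-zeroˡ (κ (inj₁ c) (inj₂ y))
            shorter (inj₂ c) σx≤c c≤y c≢y = *ₚ-vanishesˡ (κ (inj₂ c) (inj₂ y))
              (by-rank n x c σx≤c (ℕ.<-≤-trans (r-<ʳ σx≤c (c≤y , c≢y)) (ℕ.≤-pred r<n)))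
            invariant : revᴵ E (inj₁ x) (inj₂ y) ≈ₚ E (inj₁ x) (inj₂ y)
            invariant = begin
              revᴵ E (inj₁ x) (inj₂ y)
                ≈⟨ E-rev x y σx≤y ⟩
              (restrictXY E ⋆ κ) (inj₁ x) (inj₂ y)
                ≈⟨ ⋆-single-term (restrictXY E) κ {inj₁ x} {inj₂ y} (inj₂ y) σx≤y (Y-poset.≤-refl y) shorter ⟩
              E (inj₁ x) (inj₂ y) *ₚ κ (inj₂ y) (inj₂ y)
                ≈⟨ *ₚ-cong (≈ₚ-refl {E (inj₁ x) (inj₂ y)}) (κ-diag (inj₂ y)) ⟩
              E (inj₁ x) (inj₂ y) *ₚ 1ₚ
                ≈⟨ *ₚ-identityʳ (E (inj₁ x) (inj₂ y)) ⟩
              E (inj₁ x) (inj₂ y) ∎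
              where open ≈ₚ-Reasoning

    rightKLS-onXY⇒0 : ∀ E → OnXY (λ z z' → revᴵ E z z' ≈ₚ (κ ⋆ restrictXY E) z z') →
                      OnXY (λ z z' → DegLtHalf (r z z') (E z z')) → OnXY (λ z z' → E z z' ≈ₚ 0ₚ)
    rightKLS-onXY⇒0 E E-rev E-small x y σx≤y = by-rank (suc (r (inj₁ x) (inj₂ y))) x y σx≤y ℕ.≤-refl
      where
        by-rank : ∀ n x y → σ x Y.≤ y → r (inj₁ x) (inj₂ y) < n → E (inj₁ x) (inj₂ y) ≈ₚ 0ₚ
        by-rank (suc n) x y σx≤y r<n = rev-invariant⇒0 (r (inj₁ x) (inj₂ y)) invariant (E-small x y σx≤y)
          where
            shorter : ∀ w → inj₁ x ≤ w → w ≤ inj₂ y → w ≢ inj₁ x → κ (inj₁ x) w *ₚ restrictXY E w (inj₂ y) ≈ₚ 0ₚ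
            shorter (inj₂ c) _    _    _   = *ₚ-zeroʳ (κ (inj₁ x) (inj₂ c))
            shorter (inj₁ c) x≤c σc≤y c≢x = *ₚ-vanishesʳ (κ (inj₁ x) (inj₁ c))
              (by-rank n c y σc≤y (ℕ.<-≤-trans (r-<ˡ (x≤c , c≢x ∘ sym) σc≤y) (ℕ.≤-pred r<n)))
            invariant : revᴵ E (inj₁ x) (inj₂ y) ≈ₚ E (inj₁ x) (inj₂ y)
            invariant = begin
              revᴵ E (inj₁ x) (inj₂ y)
                ≈⟨ E-rev x y σx≤y ⟩
              (κ ⋆ restrictXY E) (inj₁ x) (inj₂ y)
                ≈⟨ ⋆-single-term κ (restrictXY E) {inj₁ x} {inj₂ y} (inj₁ x) (X-poset.≤-refl x) σx≤y shorter ⟩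
              κ (inj₁ x) (inj₁ x) *ₚ E (inj₁ x) (inj₂ y)
                ≈⟨ *ₚ-cong (κ-diag (inj₁ x)) (≈ₚ-refl {E (inj₁ x) (inj₂ y)}) ⟩
              1ₚ *ₚ E (inj₁ x) (inj₂ y)
                ≈⟨ *ₚ-identityˡ (E (inj₁ x) (inj₂ y)) ⟩
              E (inj₁ x) (inj₂ y) ∎
              where open ≈ₚ-Reasoning

    module KLSFunctions (f g : Inc Γ) (f-KLS : IsRightKLS Γ r κ f) (g-KLS : IsLeftKLS Γ r κ g)
                        (gInv : Inc Γ) (gInv-inverse : IsInverse Γ g gInv)
                        (h : Inc Γ) (h-def : t-1ₚ ·ᴵ h ≈ᴵ g ⋆ κ°) where

      open KLS r r-weak ρ (λ {z} {z'} → ρ-monotone {z} {z'}) κ hat-κ⋆κ f g f-KLS g-KLS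

      ℓ : Inc Γ
      ℓ = h ⋆ gInv

      L : Inc Γ
      L = t-1ₚ ·ᴵ ℓ

      D : Inc Γ
      D = Δ Γ r ℓ

      L≈g⋆κ°⋆hat-f : L ≈ᴵ g ⋆ κ° ⋆ hat f
      L≈g⋆κ°⋆hat-f = begin
        t-1ₚ ·ᴵ (h ⋆ gInv)       ≈⟨ ·ᴵ-⋆ t-1ₚ h gInv ⟩
        (t-1ₚ ·ᴵ h) ⋆ gInv       ≈⟨ ⋆-cong h-def (gInv≈hat-f gInv gInv-inverse) ⟩
        g ⋆ κ° ⋆ hat f           ∎
        where open ≈ᴵ-Reasoning

      L-supported : SupportedOnXY L
      L-supported = SupportedOnXY-cong (≈ᴵ-sym L≈g⋆κ°⋆hat-f)
        (SupportedOnXY-⋆ˡ {g ⋆ κ°} (hat f) (SupportedOnXY-⋆ʳ g {κ°} κ°-supported))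

      L-diag : ∀ z → L z z ≈ₚ 0ₚ
      L-diag (inj₁ x) = proj₁ L-supported x x (X-poset.≤-refl x)
      L-diag (inj₂ y) = proj₂ L-supported y y (Y-poset.≤-refl y)

      L∈𝓘 : InCalI Γ r L
      L∈𝓘 = InCalI-cong (≈ᴵ-sym L≈g⋆κ°⋆hat-f) (InCalI-⋆ (InCalI-⋆ g∈𝓘 κ°∈𝓘) (InCalI-hat f∈𝓘))

      L-antisymmetric : revᴵ L ≈ᴵ -ᴵ L
      L-antisymmetric = begin
        revᴵ L
          ≈⟨ revᴵ-cong L≈g⋆κ°⋆hat-f ⟩
        revᴵ (g ⋆ κ° ⋆ hat f)
          ≈⟨ revᴵ-⋆ (InCalI-⋆ g∈𝓘 κ°∈𝓘) (InCalI-hat f∈𝓘) ⟩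
        revᴵ (g ⋆ κ°) ⋆ revᴵ (hat f)
          ≈⟨ ⋆-cong (revᴵ-⋆ g∈𝓘 κ°∈𝓘) (≈ᴵ-sym (hat-revI r f)) ⟩
        (revᴵ g ⋆ revᴵ κ°) ⋆ hat (revᴵ f)
          ≈⟨ ⋆-cong (⋆-cong g-rev κ°-rev) (≈ᴵ-trans (hat-cong f-rev) (hat-⋆ κ f)) ⟩
        (g ⋆ κ ⋆ hat κ°) ⋆ (hat κ ⋆ hat f)
          ≈⟨ ⋆-congˡ (hat κ ⋆ hat f) (⋆-assoc g κ (hat κ°)) ⟩
        (g ⋆ (κ ⋆ hat κ°)) ⋆ (hat κ ⋆ hat f)
          ≈⟨ ⋆-congˡ (hat κ ⋆ hat f) (⋆-congʳ g (≈ᴵ-trans κ⋆hat-κ° (-ᴵ-cong (≈ᴵ-sym κ°⋆κ)))) ⟩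
        (g ⋆ -ᴵ (κ° ⋆ κ)) ⋆ (hat κ ⋆ hat f)
          ≈⟨ ⋆-congˡ (hat κ ⋆ hat f) (⋆-negʳ g (κ° ⋆ κ)) ⟩
        (-ᴵ (g ⋆ (κ° ⋆ κ))) ⋆ (hat κ ⋆ hat f)
          ≈⟨ ⋆-negˡ (g ⋆ (κ° ⋆ κ)) (hat κ ⋆ hat f) ⟩
        -ᴵ ((g ⋆ (κ° ⋆ κ)) ⋆ (hat κ ⋆ hat f))
          ≈⟨ -ᴵ-cong cancel-κ ⟩
        -ᴵ (g ⋆ κ° ⋆ hat f)
          ≈⟨ -ᴵ-cong (≈ᴵ-sym L≈g⋆κ°⋆hat-f) ⟩
        -ᴵ L ∎
        where
          open ≈ᴵ-Reasoning
          cancel-κ : (g ⋆ (κ° ⋆ κ)) ⋆ (hat κ ⋆ hat f) ≈ᴵ g ⋆ κ° ⋆ hat f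
          cancel-κ = begin
            (g ⋆ (κ° ⋆ κ)) ⋆ (hat κ ⋆ hat f)    ≈⟨ ⋆-congˡ (hat κ ⋆ hat f) (⋆-assoc g κ° κ) ⟨
            (g ⋆ κ° ⋆ κ) ⋆ (hat κ ⋆ hat f)      ≈⟨ ⋆-assoc (g ⋆ κ°) κ (hat κ ⋆ hat f) ⟩
            g ⋆ κ° ⋆ (κ ⋆ (hat κ ⋆ hat f))      ≈⟨ ⋆-congʳ (g ⋆ κ°) (⋆-assoc κ (hat κ) (hat f)) ⟨
            g ⋆ κ° ⋆ (κ ⋆ hat κ ⋆ hat f)        ≈⟨ ⋆-congʳ (g ⋆ κ°) (⋆-congˡ (hat f) κ⋆hat-κ) ⟩
            g ⋆ κ° ⋆ (1ᴵ ⋆ hat f)               ≈⟨ ⋆-congʳ (g ⋆ κ°) (⋆-identityˡ (hat f)) ⟩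
            g ⋆ κ° ⋆ hat f                      ∎

      L⋆g : L ⋆ g ≈ᴵ g ⋆ κ°
      L⋆g = begin
        L ⋆ g                  ≈⟨ ⋆-congˡ g L≈g⋆κ°⋆hat-f ⟩
        g ⋆ κ° ⋆ hat f ⋆ g     ≈⟨ ⋆-assoc (g ⋆ κ°) (hat f) g ⟩
        g ⋆ κ° ⋆ (hat f ⋆ g)   ≈⟨ ⋆-congʳ (g ⋆ κ°) (hat-f⋆g gInv gInv-inverse) ⟩
        g ⋆ κ° ⋆ 1ᴵ            ≈⟨ ⋆-identityʳ (g ⋆ κ°) ⟩
        g ⋆ κ°                 ∎
        where open ≈ᴵ-Reasoning

      D-where-L-vanishes : ∀ {z z'} → z ≤ z' → L z z' ≈ₚ 0ₚ → D z z' ≈ₚ 0ₚ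
      D-where-L-vanishes {z} {z'} z≤z' L≈0 = diagonal-or-strict z≤z' (λ { refl → Δ-diag ℓ z }) λ z<z' k →
        case-split k z<z' (k ℕ.+ k ℕ.<? r z z')
        where
          case-split : ∀ k → z <ᴾ z' → Dec (k ℕ.+ k < r z z') → D z z' k ≡ 0ℤ
          case-split k z<z' (yes 2k<r) = trans (proj₁ (Δ-lowerHalf ℓ z<z') k 2k<r) (cong -_ (L≈0 k))
          case-split k z<z' (no  2k≮r) = proj₂ (Δ-lowerHalf ℓ z<z') k (ℕ.≮⇒≥ 2k≮r)

      D-supported : SupportedOnXY D
      D-supported = (λ x x' x≤x' → D-where-L-vanishes x≤x' (proj₁ L-supported x x' x≤x')) ,
                    (λ y y' y≤y' → D-where-L-vanishes y≤y' (proj₂ L-supported y y' y≤y'))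

      D-LowDegree : LowDegree D
      D-LowDegree = (λ z z' z<z' → proj₂ (Δ-lowerHalf ℓ z<z')) , (λ z k _ → Δ-diag ℓ z k)

      D∈𝓘 : InCalI Γ r D
      D∈𝓘 z z' z≤z' = diagonal-or-strict z≤z' (λ { refl k _ → Δ-diag ℓ z k })
        λ z<z' k r<k → proj₁ D-LowDegree z z' z<z' k (ℕ.≤-trans (ℕ.<⇒≤ r<k) (ℕ.m≤m+n k k))

      D-rev : revᴵ D ≈ᴵ D +ᴵ L
      D-rev z z' z≤z' = diagonal-or-strict z≤z'
        (λ { refl k → trans (rev-cong (r z z) (Δ-diag ℓ z) k)
                            (trans (rev-0ₚ (r z z) k) (sym (cong₂ _+_ (Δ-diag ℓ z k) (L-diag z k)))) })
        (λ z<z' → rev-lowerHalf (r z z') (L∈𝓘 z z' z≤z') (L-antisymmetric z z' z≤z') (Δ-lowerHalf ℓ z<z'))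

      rev-D⋆g : revᴵ (D ⋆ g) ≈ᴵ restrictXY (D ⋆ g) ⋆ κ +ᴵ g ⋆ restrictXY κ
      rev-D⋆g = begin
        revᴵ (D ⋆ g)
          ≈⟨ revᴵ-⋆ D∈𝓘 g∈𝓘 ⟩
        revᴵ D ⋆ revᴵ g
          ≈⟨ ⋆-cong D-rev g-rev ⟩
        (D +ᴵ L) ⋆ (g ⋆ κ)
          ≈⟨ ⋆-distribʳ (g ⋆ κ) D L ⟩
        D ⋆ (g ⋆ κ) +ᴵ L ⋆ (g ⋆ κ)
          ≈⟨ +ᴵ-cong (⋆-assoc D g κ) (⋆-assoc L g κ) ⟨
        D ⋆ g ⋆ κ +ᴵ L ⋆ g ⋆ κ
          ≈⟨ +ᴵ-cong (⋆-congˡ κ (supported⇒≈restrictXY (SupportedOnXY-⋆ˡ {D} g D-supported))) (⋆-congˡ κ L⋆g) ⟩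
        restrictXY (D ⋆ g) ⋆ κ +ᴵ g ⋆ κ° ⋆ κ
          ≈⟨ +ᴵ-cong (≈ᴵ-refl {restrictXY (D ⋆ g) ⋆ κ}) (≈ᴵ-trans (⋆-assoc g κ° κ) (⋆-congʳ g κ°⋆κ)) ⟩
        restrictXY (D ⋆ g) ⋆ κ +ᴵ g ⋆ restrictXY κ ∎
        where open ≈ᴵ-Reasoning

      g-onXY : OnXY (λ z z' → g z z' ≈ₚ (D ⋆ g) z z')
      g-onXY x y σx≤y k = trans (inverseˡ-unique _ _ (leftKLS-onXY⇒0 E E-rev E-small x y σx≤y k))
                                (ℤ.neg-involutive ((D ⋆ g) (inj₁ x) (inj₂ y) k))
        where
          E : Inc Γ
          E = g +ᴵ -ᴵ (D ⋆ g)
          E-small : OnXY (λ z z' → DegLtHalf (r z z') (E z z'))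
          E-small x y σx≤y = DegLtHalf-+ₚ (proj₁ g-LowDegree _ _ (σx≤y , λ ()))
                                          (DegLtHalf--ₚ (proj₁ (LowDegree-⋆ D-LowDegree g-LowDegree) _ _ (σx≤y , λ ())))
          E-rev : OnXY (λ z z' → revᴵ E z z' ≈ₚ (restrictXY E ⋆ κ) z z')
          E-rev x y σx≤y k = begin
            rev R (g z z' +ₚ -ₚ (D ⋆ g) z z') k            ≡⟨ trans (rev-+ₚ R (g z z') (-ₚ (D ⋆ g) z z') k)
                                                                   (cong (rev R (g z z') k +_) (rev--ₚ R ((D ⋆ g) z z') k)) ⟩
            rev R (g z z') k + - rev R ((D ⋆ g) z z') k    ≡⟨ cong₂ (λ a b → a + - b) (trans (g-rev z z' σx≤y k) (⋆-splitXY g κ x y k))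
                                                                                     (rev-D⋆g z z' σx≤y k) ⟩
            (α + β) + - (γ + α)                            ≡⟨ cancel α β γ ⟩
            β + - γ                                        ≡⟨ ≈ᴵ-sym restrictXY-E⋆κ z z' σx≤y k ⟩
            (restrictXY E ⋆ κ) z z' k                      ∎
            where
              open ≡-Reasoning
              z = inj₁ x
              z' = inj₂ y
              R = r z z'
              α = (g ⋆ restrictXY κ) z z' k
              β = (restrictXY g ⋆ κ) z z' k
              γ = (restrictXY (D ⋆ g) ⋆ κ) z z' k
              cancel : ∀ a b c → (a + b) + - (c + a) ≡ b + - c
              cancel = solve-∀
              restrictXY-E⋆κ : restrictXY E ⋆ κ ≈ᴵ restrictXY g ⋆ κ +ᴵ -ᴵ (restrictXY (D ⋆ g) ⋆ κ)
              restrictXY-E⋆κ = ≈ᴵ-trans (⋆-congˡ κ (restrictXY-+ᴵ g (-ᴵ (D ⋆ g))))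
                                (≈ᴵ-trans (⋆-distribʳ κ (restrictXY g) (restrictXY (-ᴵ (D ⋆ g))))
                                          (+ᴵ-cong (≈ᴵ-refl {restrictXY g ⋆ κ})
                                                   (≈ᴵ-trans (⋆-congˡ κ (restrictXY--ᴵ (D ⋆ g))) (⋆-negˡ (restrictXY (D ⋆ g)) κ))))

      hat-D-rev : revᴵ (hat D) ≈ᴵ hat D +ᴵ hat L
      hat-D-rev = begin
        revᴵ (hat D)      ≈⟨ hat-revI r D ⟨
        hat (revᴵ D)      ≈⟨ hat-cong D-rev ⟩
        hat (D +ᴵ L)      ≈⟨ hat-+ᴵ D L ⟩
        hat D +ᴵ hat L    ∎
        where open ≈ᴵ-Reasoning

      κ⋆f⋆hat-L : κ ⋆ f ⋆ hat L ≈ᴵ -ᴵ (restrictXY κ ⋆ f)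
      κ⋆f⋆hat-L = begin
        κ ⋆ f ⋆ hat L                          ≈⟨ ⋆-congʳ (κ ⋆ f) hat-L ⟩
        κ ⋆ f ⋆ (hat g ⋆ hat κ° ⋆ f)           ≈⟨ ⋆-assoc κ f (hat g ⋆ hat κ° ⋆ f) ⟩
        κ ⋆ (f ⋆ (hat g ⋆ hat κ° ⋆ f))         ≈⟨ ⋆-congʳ κ cancel-g ⟩
        κ ⋆ (hat κ° ⋆ f)                       ≈⟨ ⋆-assoc κ (hat κ°) f ⟨
        κ ⋆ hat κ° ⋆ f                         ≈⟨ ⋆-congˡ f κ⋆hat-κ° ⟩
        (-ᴵ restrictXY κ) ⋆ f                  ≈⟨ ⋆-negˡ (restrictXY κ) f ⟩
        -ᴵ (restrictXY κ ⋆ f)                  ∎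
        where
          open ≈ᴵ-Reasoning
          hat-L : hat L ≈ᴵ hat g ⋆ hat κ° ⋆ f
          hat-L = begin
            hat L                            ≈⟨ hat-cong L≈g⋆κ°⋆hat-f ⟩
            hat (g ⋆ κ° ⋆ hat f)             ≈⟨ hat-⋆ (g ⋆ κ°) (hat f) ⟩
            hat (g ⋆ κ°) ⋆ hat (hat f)       ≈⟨ ⋆-cong (hat-⋆ g κ°) (hat-involutive f) ⟩
            hat g ⋆ hat κ° ⋆ f               ∎
          cancel-g : f ⋆ (hat g ⋆ hat κ° ⋆ f) ≈ᴵ hat κ° ⋆ f
          cancel-g = begin
            f ⋆ (hat g ⋆ hat κ° ⋆ f)         ≈⟨ ⋆-assoc f (hat g ⋆ hat κ°) f ⟨
            f ⋆ (hat g ⋆ hat κ°) ⋆ f         ≈⟨ ⋆-congˡ f (⋆-assoc f (hat g) (hat κ°)) ⟨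
            f ⋆ hat g ⋆ hat κ° ⋆ f           ≈⟨ ⋆-congˡ f (⋆-congˡ (hat κ°) (f⋆hat-g gInv gInv-inverse)) ⟩
            1ᴵ ⋆ hat κ° ⋆ f                  ≈⟨ ⋆-congˡ f (⋆-identityˡ (hat κ°)) ⟩
            hat κ° ⋆ f                       ∎

      f⋆hat-D-supported : SupportedOnXY (f ⋆ hat D)
      f⋆hat-D-supported = SupportedOnXY-⋆ʳ f {hat D} (SupportedOnXY-hat {D} D-supported)

      rev-f⋆hat-D : revᴵ (f ⋆ hat D) ≈ᴵ κ ⋆ restrictXY (f ⋆ hat D) +ᴵ -ᴵ (restrictXY κ ⋆ f)
      rev-f⋆hat-D = begin
        revᴵ (f ⋆ hat D)
          ≈⟨ revᴵ-⋆ f∈𝓘 (InCalI-hat D∈𝓘) ⟩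
        revᴵ f ⋆ revᴵ (hat D)
          ≈⟨ ⋆-cong f-rev hat-D-rev ⟩
        κ ⋆ f ⋆ (hat D +ᴵ hat L)
          ≈⟨ ⋆-distribˡ (κ ⋆ f) (hat D) (hat L) ⟩
        κ ⋆ f ⋆ hat D +ᴵ κ ⋆ f ⋆ hat L
          ≈⟨ +ᴵ-cong (⋆-assoc κ f (hat D)) κ⋆f⋆hat-L ⟩
        κ ⋆ (f ⋆ hat D) +ᴵ -ᴵ (restrictXY κ ⋆ f)
          ≈⟨ +ᴵ-cong (⋆-congʳ κ (supported⇒≈restrictXY f⋆hat-D-supported)) (≈ᴵ-refl { -ᴵ (restrictXY κ ⋆ f)}) ⟩
        κ ⋆ restrictXY (f ⋆ hat D) +ᴵ -ᴵ (restrictXY κ ⋆ f) ∎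
        where open ≈ᴵ-Reasoning

      f-onXY : OnXY (λ z z' → f z z' ≈ₚ -ₚ (f ⋆ hat D) z z')
      f-onXY x y σx≤y k = inverseˡ-unique _ _ (rightKLS-onXY⇒0 E E-rev E-small x y σx≤y k)
        where
          E : Inc Γ
          E = f +ᴵ f ⋆ hat D
          E-small : OnXY (λ z z' → DegLtHalf (r z z') (E z z'))
          E-small x y σx≤y = DegLtHalf-+ₚ (proj₁ f-LowDegree _ _ (σx≤y , λ ()))
                                          (proj₁ (LowDegree-⋆ f-LowDegree (LowDegree-hat D-LowDegree)) _ _ (σx≤y , λ ()))
          E-rev : OnXY (λ z z' → revᴵ E z z' ≈ₚ (κ ⋆ restrictXY E) z z')
          E-rev x y σx≤y k = begin
            rev R (f z z' +ₚ (f ⋆ hat D) z z') k           ≡⟨ rev-+ₚ R (f z z') ((f ⋆ hat D) z z') k ⟩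
            rev R (f z z') k + rev R ((f ⋆ hat D) z z') k  ≡⟨ cong₂ _+_ (trans (f-rev z z' σx≤y k) (⋆-splitXY κ f x y k))
                                                                        (rev-f⋆hat-D z z' σx≤y k) ⟩
            (α + β) + (γ + - β)                            ≡⟨ cancel α β γ ⟩
            α + γ                                          ≡⟨ ≈ᴵ-sym κ⋆restrictXY-E z z' σx≤y k ⟩
            (κ ⋆ restrictXY E) z z' k                      ∎
            where
              open ≡-Reasoning
              z = inj₁ x
              z' = inj₂ y
              R = r z z'
              α = (κ ⋆ restrictXY f) z z' k
              β = (restrictXY κ ⋆ f) z z' k
              γ = (κ ⋆ restrictXY (f ⋆ hat D)) z z' k
              cancel : ∀ a b c → (a + b) + (c + - b) ≡ a + c
              cancel = solve-∀
              κ⋆restrictXY-E : κ ⋆ restrictXY E ≈ᴵ κ ⋆ restrictXY f +ᴵ κ ⋆ restrictXY (f ⋆ hat D)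
              κ⋆restrictXY-E = ≈ᴵ-trans (⋆-congʳ κ (restrictXY-+ᴵ f (f ⋆ hat D)))
                                        (⋆-distribˡ κ (restrictXY f) (restrictXY (f ⋆ hat D)))

      Z : Inc Γ
      Z = g ⋆ κ ⋆ f

      restrictXY-f : restrictXY f ≈ᴵ -ᴵ (f ⋆ hat D)
      restrictXY-f (inj₁ x) (inj₂ y) σx≤y   = f-onXY x y σx≤y
      restrictXY-f (inj₁ x) (inj₁ x') x≤x' k = cong -_ (sym (proj₁ f⋆hat-D-supported x x' x≤x' k))
      restrictXY-f (inj₂ y) (inj₂ y') y≤y' k = cong -_ (sym (proj₂ f⋆hat-D-supported y y' y≤y' k))

      restrictXY-g⋆κ : restrictXY (g ⋆ κ) ≈ᴵ revᴵ D ⋆ (g ⋆ κ)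
      restrictXY-g⋆κ (inj₁ x) (inj₂ y) σx≤y = begin
        (g ⋆ κ) (inj₁ x) (inj₂ y)               ≈⟨ g-rev (inj₁ x) (inj₂ y) σx≤y ⟨
        revᴵ g (inj₁ x) (inj₂ y)                ≈⟨ rev-cong (r (inj₁ x) (inj₂ y)) (g-onXY x y σx≤y) ⟩
        revᴵ (D ⋆ g) (inj₁ x) (inj₂ y)          ≈⟨ revᴵ-⋆ D∈𝓘 g∈𝓘 (inj₁ x) (inj₂ y) σx≤y ⟩
        (revᴵ D ⋆ revᴵ g) (inj₁ x) (inj₂ y)     ≈⟨ ⋆-congʳ (revᴵ D) g-rev (inj₁ x) (inj₂ y) σx≤y ⟩
        (revᴵ D ⋆ (g ⋆ κ)) (inj₁ x) (inj₂ y)    ∎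
        where open ≈ₚ-Reasoning
      restrictXY-g⋆κ (inj₁ x) (inj₁ x') x≤x' =
        ≈ₚ-sym (proj₁ (SupportedOnXY-⋆ˡ {revᴵ D} (g ⋆ κ) (SupportedOnXY-rev {D} D-supported)) x x' x≤x')
      restrictXY-g⋆κ (inj₂ y) (inj₂ y') y≤y' =
        ≈ₚ-sym (proj₂ (SupportedOnXY-⋆ˡ {revᴵ D} (g ⋆ κ) (SupportedOnXY-rev {D} D-supported)) y y' y≤y')

      Z-onXY : OnXY (λ z z' → Z z z' ≈ₚ (-ᴵ (Z ⋆ hat D)) z z' +ₚ (revᴵ D ⋆ Z) z z')
      Z-onXY x y σx≤y k = trans (⋆-splitXY (g ⋆ κ) f x y k)
                                (cong₂ _+_ (fromX (inj₁ x) (inj₂ y) σx≤y k) (toY (inj₁ x) (inj₂ y) σx≤y k))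
        where
          fromX : g ⋆ κ ⋆ restrictXY f ≈ᴵ -ᴵ (Z ⋆ hat D)
          fromX = begin
            g ⋆ κ ⋆ restrictXY f          ≈⟨ ⋆-congʳ (g ⋆ κ) restrictXY-f ⟩
            g ⋆ κ ⋆ -ᴵ (f ⋆ hat D)        ≈⟨ ⋆-negʳ (g ⋆ κ) (f ⋆ hat D) ⟩
            -ᴵ (g ⋆ κ ⋆ (f ⋆ hat D))      ≈⟨ -ᴵ-cong (⋆-assoc (g ⋆ κ) f (hat D)) ⟨
            -ᴵ (Z ⋆ hat D)                ∎
            where open ≈ᴵ-Reasoning
          toY : restrictXY (g ⋆ κ) ⋆ f ≈ᴵ revᴵ D ⋆ Z
          toY = ≈ᴵ-trans (⋆-congˡ f restrictXY-g⋆κ) (⋆-assoc (revᴵ D) (g ⋆ κ) f)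

corollary3p15 :
  (X Y : FinOrd) → IsFinPoset X → IsFinPoset Y →
  (ρX : FinOrd.Carrier X → ℕ) → (ρY : FinOrd.Carrier Y → ℕ) →
  IsLowerEulerian X ρX → IsLowerEulerian Y ρY →
  (σ : FinOrd.Carrier X → FinOrd.Carrier Y) →
  IsStrongFormalSubdivision X Y ρX ρY σ →
  (r : FinOrd.Carrier (ΓOrd X Y σ) → FinOrd.Carrier (ΓOrd X Y σ) → ℕ) →
  IsWeakRank (ΓOrd X Y σ) r →
  (κ : Inc (ΓOrd X Y σ)) →
  InCalI (ΓOrd X Y σ) r κ → InU (ΓOrd X Y σ) r κ →
  Multiplicative (ΓOrd X Y σ) κ →
  RankAlternating (ΓOrd X Y σ) r (ρΓ X Y ρX ρY) κ →
  (f g : Inc (ΓOrd X Y σ)) →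
  IsRightKLS (ΓOrd X Y σ) r κ f → IsLeftKLS (ΓOrd X Y σ) r κ g →
  (gInv : Inc (ΓOrd X Y σ)) → IsInverse (ΓOrd X Y σ) g gInv →
  (h : Inc (ΓOrd X Y σ)) →
  (∀ z z' → FinOrd._≤_ (ΓOrd X Y σ) z z' →
     t-1ₚ *ₚ h z z' ≈ₚ _⊛_ (ΓOrd X Y σ) g (restrict° X Y σ κ) z z') →
  ∀ x y → FinOrd._≤_ Y (σ x) y →
    let Z = _⊛_ (ΓOrd X Y σ) (_⊛_ (ΓOrd X Y σ) g κ) f
        ℓ = _⊛_ (ΓOrd X Y σ) h gInv
        Δℓ = Δ (ΓOrd X Y σ) r ℓ
    in
    Z (inj₁ x) (inj₂ y) ≈ₚ
      Σₚ (FinOrd.elems X)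
         (λ x' → does (FinOrd._≤?_ X x x') ∧ does (FinOrd._≤?_ Y (σ x') y))
         (λ x' → sign (ρY y ∸ ρX x') ·ₚ (Z (inj₁ x) (inj₁ x') *ₚ Δℓ (inj₁ x') (inj₂ y)))
      +ₚ
      Σₚ (FinOrd.elems Y)
         (λ y' → does (FinOrd._≤?_ Y (σ x) y') ∧ does (FinOrd._≤?_ Y y' y))
         (λ y' → rev (r (inj₁ x) (inj₂ y')) (Δℓ (inj₁ x) (inj₂ y')) *ₚ Z (inj₂ y') (inj₂ y))
corollary3p15 X Y X-poset Y-poset ρX ρY X-lowerEulerian Y-lowerEulerian σ σ-subdivision r r-weak
              κ κ∈𝓘 κ-diag κ-mult κ-alt f g f-KLS g-KLS gInv gInv-inverse h h-def x y σx≤y =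
  ≈ₚ-trans (Z-onXY x y σx≤y)
           (+ₚ-cong (neg-⋆-hat-expansion Z D D-supported x y) (rev-⋆-expansion D D-supported Z x y))
  where
    open StrongFormalSubdivision X Y X-poset Y-poset X-lowerEulerian Y-lowerEulerian σ-subdivision r-weak
    open Kernel κ κ∈𝓘 κ-diag κ-mult κ-alt
    open KLSFunctions f g f-KLS g-KLS gInv gInv-inverse h h-def
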